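{- $\mathcal{D}_m:=\mathcal{D}_{m,1}\cup\mathcal{D}_{m,2}\subset\mathcal{C}_{X_m,1,2}$, where $\mathcal{D}_{m,1}$ is the set of all $\sigma\cdot(d+1;\mathbb{Z}_p/p^{r_1}\mathbb{Z}_p,\dots,\mathbb{Z}_p/p^{r_{d+2}}\mathbb{Z}_p,\mathbb{Z}_p/p\mathbb{Z}_p,\dots,\mathbb{Z}_p/p\mathbb{Z}_p)\in\mathcal{B}_m$ with $\sigma\in S_m$, $0\le d\le m-2$ and $r_1,\dots,r_{d+2}\in\overline{\mathbb{Z}}_{\ge2}$, and $\mathcal{D}_{m,2}$ is the set of all $\sigma\cdot(d+1;(\mathbb{Z}_p/p\mathbb{Z}_p)^2,\dots,(\mathbb{Z}_p/p\mathbb{Z}_p)^2,\mathbb{Z}_p/p^{r_1}\mathbb{Z}_p,\dots,\mathbb{Z}_p/p^{r_{m-d}}\mathbb{Z}_p)\in\mathcal{B}_m$ (with $d$ entries $(\mathbb{Z}_p/p\mathbb{Z}_p)^2$) with $\sigma\in S_m$, $0\le d\le m$ and $r_1,\dots,r_{m-d}\in\overline{\mathbb{Z}}_{\ge2}$.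
   Context: Fix a prime $p$; $\mathbb{Z}_p$ is the $p$-adic integers; $\overline{\mathbb{Z}}_{\ge c}=\{x\in\mathbb{Z}:x\ge c\}\cup\{\infty\}$, $p^\infty=0$. $X_m=\{x_1,\dots,x_m\}$ is an ordered subset of $\mathbb{Z}_p$ of size $m$ with pairwise distinct reductions mod $p$. $\mathcal{M}_{\mathbb{Z}_p}$: isomorphism classes of finitely generated $\mathbb{Z}_p$-modules; $s(H)=\dim_{\mathbb{F}_p}(H/pH)$. $\mathcal{B}_m:=\{(n;H_1,\dots,H_m)\in\mathbb{Z}_{\ge0}\times\mathcal{M}_{\mathbb{Z}_p}^m: n\ge s(H_i)\ \forall i\}$; $S_m$ acts by $\sigma\cdot(n;H_1,\dots,H_m)=(n;H_{\sigma(1)},\dots,H_{\sigma(m)})$. A first integral is a polynomial in $\operatorname{M}_n(\mathbb{Z}_p)[t]$ of the form $A_0+tA_1+pt^2A_2+\dots+p^rt^{r+1}A_{r+1}$. $\mathcal{C}_{X_m,1,2}$ is the set of $(n;H_1,\dots,H_m)\in\mathcal{B}_m$ such that some first integral $P(t)\in\operatorname{M}_n(\mathbb{Z}_p)[t]$ satisfies $\operatorname{cok}_{\mathbb{Z}_p/p^2\mathbb{Z}_p}(P(x_i))\cong H_i/p^2H_i$ for all $i$ (cokernel of the reduction mod $p^2$ as a $\mathbb{Z}_p/p^2\mathbb{Z}_p$-module). -}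

module Defs where

open import Data.Nat using (ℕ; zero; suc; _+_; _*_; _∸_; _^_; _≤_; _<_; _<?_)
open import Data.Fin using (Fin; toℕ) renaming (zero to fzero; suc to fsuc)
open import Data.Fin.Permutation using (Permutation′; _⟨$⟩ʳ_)
open import Data.List using (List; []; _∷_; length; lookup)
open import Data.Product using (Σ; _×_; _,_; ∃)
open import Data.Sum using (_⊎_)
open import Data.Unit using (⊤)
open import Relation.Nullary using (yes; no)
open import Relation.Binary.PropositionalEquality using (_≡_)
open import Function.Definitions using (Injective)

-- ℕ ∪ {∞}, with p^∞ = 0
data ℕ∞ : Set where
  fin : ℕ → ℕ∞
  ∞   : ℕ∞

Ge2 : ℕ∞ → Set
Ge2 (fin k) = 2 ≤ k
Ge2 ∞       = ⊤

pow∞ : ℕ → ℕ∞ → ℕ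
pow∞ p (fin e) = p ^ e
pow∞ p ∞       = 0

-- p-adic integers as coherent sequences (x_k ∈ {0,…,p^k-1}, x_{k+1} ≡ x_k mod p^k)
record ℤₚ (p : ℕ) : Set where
  field
    seq : ℕ → ℕ
    seq-lt  : ∀ k → seq k < p ^ k
    seq-coh : ∀ k → Σ ℕ λ a → seq (suc k) ≡ seq k + a * p ^ k
open ℤₚ public

red : ∀ {p} → ℕ → ℤₚ p → ℕ
red k x = seq x k

-- Arithmetic in ℤ/qℤ via ℕ-representatives
_≡_[mod_] : ℕ → ℕ → ℕ → Set
x ≡ y [mod q ] = Σ ℕ λ a → Σ ℕ λ b → x + a * q ≡ y + b * q

sumF : (n : ℕ) → (Fin n → ℕ) → ℕ
sumF zero    f = 0
sumF (suc n) f = f fzero + sumF n (λ i → f (fsuc i))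

Mat : ℕ → ℕ → Set → Set
Mat a b A = Fin a → Fin b → A

mulV : ∀ {a b} → Mat a b ℕ → (Fin b → ℕ) → Fin a → ℕ
mulV {b = b} A v i = sumF b (λ j → A i j * v j)

-- v ≡ v' modulo (q · R^a + im A), i.e. equality in cok_{ℤ/q}(A)
≈cok : ∀ {a b} → ℕ → Mat a b ℕ → (Fin a → ℕ) → (Fin a → ℕ) → Set
≈cok {a} {b} q A v v' =
  Σ (Fin b → ℕ) λ u → Σ (Fin b → ℕ) λ u' →
    ∀ i → (v i + mulV A u i) ≡ (v' i + mulV A u' i) [mod q ]

-- cok_{ℤ/q}(A) ≅ cok_{ℤ/q}(B) as ℤ/q-modules: mutually inverse linear maps
-- (given by matrices, i.e. lifts to the free modules)
CokIso : ∀ {a a' b b'} → ℕ → Mat a a' ℕ → Mat b b' ℕ → Set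
CokIso {a} {a'} {b} {b'} q A B =
  Σ (Mat b a ℕ) λ F → Σ (Mat a b ℕ) λ G →
    (∀ v v' → ≈cok q A v v' → ≈cok q B (mulV F v) (mulV F v')) ×
    (∀ w w' → ≈cok q B w w' → ≈cok q A (mulV G w) (mulV G w')) ×
    (∀ v → ≈cok q A (mulV G (mulV F v)) v) ×
    (∀ w → ≈cok q B (mulV F (mulV G w)) w)

-- Finitely generated ℤ_p-modules up to isomorphism, via the structure theorem:
-- the list [e_1,…,e_k] stands for ⊕_j ℤ_p / p^{e_j} ℤ_p  (e_j = ∞ gives ℤ_p).
Mod : Set
Mod = List ℕ∞

-- s(H) = dim_{F_p} H/pH = number of j with e_j ≠ 0
s : Mod → ℕ
s []                 = 0
s (fin zero ∷ H)     = s H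
s (fin (suc _) ∷ H)  = suc (s H)
s (∞ ∷ H)            = suc (s H)

-- the diagonal presentation matrix diag(p^{e_1},…,p^{e_k}) of H;
-- H/p^2H = cok_{ℤ/p^2}(this matrix reduced mod p^2)
presH : ℕ → (H : Mod) → Mat (length H) (length H) ℕ
presH p H i j with toℕ i Data.Nat.≟ toℕ j
... | yes _ = pow∞ p (lookup H i)
... | no  _ = 0

-- First integrals  A_0 + t A_1 + p t^2 A_2 + … + p^r t^{r+1} A_{r+1}
record FirstIntegral (p n : ℕ) : Set where
  field
    deg  : ℕ
    coef : Fin (suc (suc deg)) → Mat n n (ℤₚ p)
open FirstIntegral public

-- scalar in front of t^k A_k : 1 for k = 0,1 and p^{k-1} for k ≥ 2
cst : ℕ → ℕ → ℕ
cst p zero    = 1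
cst p (suc k) = p ^ k

-- reduction mod p^2 of P(x): computed from the mod-p^2 reductions of x and of
-- the coefficient entries (reduction ℤ_p → ℤ/p^2 is a ring homomorphism)
evalMod2 : ∀ {p n} → FirstIntegral p n → ℤₚ p → Mat n n ℕ
evalMod2 {p} P x i j =
  sumF (suc (suc (deg P))) (λ k → cst p (toℕ k) * red 2 x ^ toℕ k * red 2 (coef P k i j))

InB : (m n : ℕ) → (Fin m → Mod) → Set
InB m n H = ∀ i → s (H i) ≤ n

InC : (p m : ℕ) → (Fin m → ℤₚ p) → (n : ℕ) → (Fin m → Mod) → Set
InC p m X n H =
  InB m n H ×
  Σ (FirstIntegral p n) λ P →
    ∀ i → CokIso (p ^ 2) (evalMod2 P (X i)) (presH p (H i))

cyc : ℕ∞ → Mod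
cyc r = r ∷ []

Fp2 : Mod
Fp2 = fin 1 ∷ fin 1 ∷ []

-- (ℤ/p^{r_1},…,ℤ/p^{r_{d+2}}, ℤ/p,…,ℤ/p), r_j = r (j-1)
base1 : ∀ {m} → ℕ → (ℕ → ℕ∞) → Fin m → Mod
base1 d r i with toℕ i <? suc (suc d)
... | yes _ = cyc (r (toℕ i))
... | no  _ = cyc (fin 1)

-- ((ℤ/p)^2,…,(ℤ/p)^2 [d times], ℤ/p^{r_1},…,ℤ/p^{r_{m-d}}), r_j = r (j-1)
base2 : ∀ {m} → ℕ → (ℕ → ℕ∞) → Fin m → Mod
base2 d r i with toℕ i <? d
... | yes _ = Fp2
... | no  _ = cyc (r (toℕ i ∸ d))

-- σ·(n; H_1,…,H_m) = (n; H_{σ(1)},…,H_{σ(m)})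
InD1 : (m n : ℕ) → (Fin m → Mod) → Set
InD1 m n H =
  Σ ℕ λ d → (d + 2 ≤ m) × Σ (ℕ → ℕ∞) λ r → (∀ j → j < d + 2 → Ge2 (r j)) ×
  Σ (Permutation′ m) λ σ → (n ≡ suc d) × (∀ i → H i ≡ base1 d r (σ ⟨$⟩ʳ i)) × InB m n H

InD2 : (m n : ℕ) → (Fin m → Mod) → Set
InD2 m n H =
  Σ ℕ λ d → (d ≤ m) × Σ (ℕ → ℕ∞) λ r → (∀ j → j < m ∸ d → Ge2 (r j)) ×
  Σ (Permutation′ m) λ σ → (n ≡ suc d) × (∀ i → H i ≡ base2 d r (σ ⟨$⟩ʳ i)) × InB m n H

InD : (m n : ℕ) → (Fin m → Mod) → Set
InD m n H = InD1 m n H ⊎ InD2 m n H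

DistinctModP : ∀ {p m} → (Fin m → ℤₚ p) → Set
DistinctModP X = Injective _≡_ _≡_ (λ i → red 1 (X i))

-- Both families are realised by first integrals A₀ + t A₁ + p t² A₂ whose values are arrowhead
-- matrices [[α, β], [γ, diag D]] over ℤ/p², with one tail entry D_k(x) = x − c_k (+ p) for each
-- point c_k in the first d positions. At a point x_i every D_k(x_i) is a unit except the one at
-- x_i's own position, so eliminating the unit part of the tail (a Schur complement) reduces the
-- cokernel to that of a 1×1 or 2×2 matrix.
-- For D_{m,1} the head is T(x) = p(x − a)(x − b), with a, b the points at positions d and d + 1,
-- β = 0 and γ = 1: at the first d + 2 positions a tail entry or T vanishes and the cokernel is ℤ/p²,
-- elsewhere T is p times a unit and the cokernel is ℤ/p.
-- For D_{m,2} the head is 0 with β = p and γ = −p: the Schur complement is a multiple of p², so the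
-- cokernel is ℤ/p², except at the first d positions, where the tail entry p leaves [[0, p], [−p, p]]
-- with cokernel (ℤ/p)².

module Submission where

open import Defs
open import Data.Nat using (ℕ)
open import Data.Nat.Primality using (Prime)
open import Data.Fin using (Fin)

open import Data.Fin using (toℕ; fromℕ<) renaming (zero to fzero; suc to fsuc)
open import Data.Fin.Permutation using (Permutation′; _⟨$⟩ʳ_; _⟨$⟩ˡ_; inverseˡ; inverseʳ)
open import Data.Fin.Properties using (_≟_; toℕ<n; toℕ-fromℕ<; fromℕ<-toℕ; toℕ-injective)
open import Data.Nat using (zero; suc; _+_; _*_; _∸_; _^_; _<_; _≤_; _<?_; s≤s; z≤n; NonZero; >-nonZero⁻¹)
open import Data.Nat.Coprimality using (Coprime; coprime-Bézout; coprime-divisor)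
import Data.Nat.Coprimality as Coprimality
open import Data.Nat.DivMod using (_%_; _/_; m%n<n; m≡m%n+[m/n]*n; [m+kn]%n≡m%n; m<n⇒m%n≡m)
open import Data.Nat.Divisibility using (_∣_; divides; ∣-trans)
open import Data.Nat.GCD using (module Bézout)
open import Data.Nat.Primality using (prime⇒nonZero; prime⇒irreducible)
open import Data.Nat.Properties hiding (_≟_)
import Data.Nat.Properties as ℕ
open import Data.Nat.Tactic.RingSolver using (solve-∀)
open import Algebra.Properties.CommutativeSemigroup +-commutativeSemigroup
  using () renaming (interchange to +-interchange; xy∙z≈xz∙y to +-right-comm)
open import Data.Product using (Σ; _×_; _,_; proj₁; proj₂)
open import Data.Sum using (inj₁; inj₂)
open import Relation.Binary.Bundles using (Setoid)
open import Relation.Binary.PropositionalEquality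
import Relation.Binary.Reasoning.Setoid as SetoidReasoning
open import Relation.Nullary using (¬_; contradiction; yes; no)

-- Finite sums and matrices

sumF-zero : ∀ n → sumF n (λ _ → 0) ≡ 0
sumF-zero zero    = refl
sumF-zero (suc n) = sumF-zero n

sumF-cong : ∀ n {f g : Fin n → ℕ} → (∀ i → f i ≡ g i) → sumF n f ≡ sumF n g
sumF-cong zero    f≡g = refl
sumF-cong (suc n) f≡g = cong₂ _+_ (f≡g fzero) (sumF-cong n (λ i → f≡g (fsuc i)))

sumF-+ : ∀ n (f g : Fin n → ℕ) → sumF n (λ i → f i + g i) ≡ sumF n f + sumF n g
sumF-+ zero    f g = refl
sumF-+ (suc n) f g = begin
  f fzero + g fzero + sumF n (λ i → f (fsuc i) + g (fsuc i))
    ≡⟨ cong (f fzero + g fzero +_) (sumF-+ n (λ i → f (fsuc i)) (λ i → g (fsuc i))) ⟩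
  f fzero + g fzero + (sumF n (λ i → f (fsuc i)) + sumF n (λ i → g (fsuc i)))
    ≡⟨ +-interchange (f fzero) (g fzero) _ _ ⟩
  f fzero + sumF n (λ i → f (fsuc i)) + (g fzero + sumF n (λ i → g (fsuc i))) ∎
  where open ≡-Reasoning

*-distribˡ-sumF : ∀ n c (f : Fin n → ℕ) → c * sumF n f ≡ sumF n (λ i → c * f i)
*-distribˡ-sumF zero    c f = *-zeroʳ c
*-distribˡ-sumF (suc n) c f =
  trans (*-distribˡ-+ c (f fzero) _) (cong (c * f fzero +_) (*-distribˡ-sumF n c (λ i → f (fsuc i))))

*-distribʳ-sumF : ∀ n c (f : Fin n → ℕ) → sumF n f * c ≡ sumF n (λ i → f i * c)
*-distribʳ-sumF n c f =
  trans (*-comm (sumF n f) c) (trans (*-distribˡ-sumF n c f) (sumF-cong n (λ i → *-comm c (f i))))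

sumF-swap : ∀ a b (f : Fin a → Fin b → ℕ) →
  sumF a (λ i → sumF b (f i)) ≡ sumF b (λ j → sumF a (λ i → f i j))
sumF-swap zero    b f = sym (sumF-zero b)
sumF-swap (suc a) b f =
  trans (cong (sumF b (f fzero) +_) (sumF-swap a b (λ i → f (fsuc i))))
        (sym (sumF-+ b (f fzero) _))

infixl 7 _⊗_
infixl 6 _⊕_

_⊗_ : ∀ {a b c} → Mat a b ℕ → Mat b c ℕ → Mat a c ℕ
_⊗_ {b = b} F G i j = sumF b (λ k → F i k * G k j)

_⊕_ : ∀ {a b} → Mat a b ℕ → Mat a b ℕ → Mat a b ℕ
(A ⊕ B) i j = A i j + B i j

mulV-⊗ : ∀ {a b c} (F : Mat a b ℕ) (G : Mat b c ℕ) v i →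
  mulV (F ⊗ G) v i ≡ mulV F (mulV G v) i
mulV-⊗ {b = b} {c} F G v i = begin
  sumF c (λ j → sumF b (λ k → F i k * G k j) * v j)
    ≡⟨ sumF-cong c (λ j → *-distribʳ-sumF b (v j) _) ⟩
  sumF c (λ j → sumF b (λ k → F i k * G k j * v j))
    ≡⟨ sym (sumF-swap b c _) ⟩
  sumF b (λ k → sumF c (λ j → F i k * G k j * v j))
    ≡⟨ sumF-cong b (λ k → trans (sumF-cong c (λ j → *-assoc (F i k) _ _))
                                (sym (*-distribˡ-sumF c (F i k) _))) ⟩
  sumF b (λ k → F i k * sumF c (λ j → G k j * v j)) ∎
  where open ≡-Reasoning

mulV-⊕ : ∀ {a b} (A B : Mat a b ℕ) v i → mulV (A ⊕ B) v i ≡ mulV A v i + mulV B v i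
mulV-⊕ {b = b} A B v i =
  trans (sumF-cong b (λ j → *-distribʳ-+ (v j) (A i j) (B i j))) (sumF-+ b _ _)

mulV-+ : ∀ {a b} (A : Mat a b ℕ) (u v : Fin b → ℕ) i →
  mulV A (λ j → u j + v j) i ≡ mulV A u i + mulV A v i
mulV-+ {b = b} A u v i =
  trans (sumF-cong b (λ j → *-distribˡ-+ (A i j) (u j) (v j))) (sumF-+ b _ _)

sumF-*-zero : ∀ n (f : Fin n → ℕ) → sumF n (λ i → f i * 0) ≡ 0
sumF-*-zero n f = trans (sumF-cong n (λ i → *-zeroʳ (f i))) (sumF-zero n)

mulV-zero : ∀ {a b} (A : Mat a b ℕ) i → mulV A (λ _ → 0) i ≡ 0
mulV-zero {b = b} A i = sumF-*-zero b (A i)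

diagonal : ∀ {n} → (Fin n → ℕ) → Mat n n ℕ
diagonal D fzero    fzero    = D fzero
diagonal D fzero    (fsuc l) = 0
diagonal D (fsuc k) fzero    = 0
diagonal D (fsuc k) (fsuc l) = diagonal (λ i → D (fsuc i)) k l

identity : ∀ {n} → Mat n n ℕ
identity = diagonal (λ _ → 1)

diagonal-diag : ∀ {n} (D : Fin n → ℕ) k → diagonal D k k ≡ D k
diagonal-diag D fzero    = refl
diagonal-diag D (fsuc k) = diagonal-diag (λ i → D (fsuc i)) k

diagonal-offDiag : ∀ {n} (D : Fin n → ℕ) {k l} → ¬ k ≡ l → diagonal D k l ≡ 0
diagonal-offDiag D {fzero}  {fzero}  k≢l = contradiction refl k≢l
diagonal-offDiag D {fzero}  {fsuc l} k≢l = refl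
diagonal-offDiag D {fsuc k} {fzero}  k≢l = refl
diagonal-offDiag D {fsuc k} {fsuc l} k≢l = diagonal-offDiag (λ i → D (fsuc i)) (λ k≡l → k≢l (cong fsuc k≡l))

sumF-diagonalˡ : ∀ {n} (D f : Fin n → ℕ) k → sumF n (λ l → diagonal D k l * f l) ≡ D k * f k
sumF-diagonalˡ {suc n} D f fzero =
  trans (cong (D fzero * f fzero +_) (sumF-zero n)) (+-identityʳ _)
sumF-diagonalˡ {suc n} D f (fsuc k) = sumF-diagonalˡ (λ i → D (fsuc i)) (λ i → f (fsuc i)) k

sumF-diagonalʳ : ∀ {n} (D f : Fin n → ℕ) m → sumF n (λ l → f l * diagonal D l m) ≡ f m * D m
sumF-diagonalʳ {suc n} D f fzero =
  trans (cong (f fzero * D fzero +_) (trans (sumF-cong n (λ i → *-zeroʳ (f (fsuc i)))) (sumF-zero n)))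
        (+-identityʳ _)
sumF-diagonalʳ {suc n} D f (fsuc m) =
  trans (cong (_+ sumF n (λ l → f (fsuc l) * diagonal (λ i → D (fsuc i)) l m)) (*-zeroʳ (f fzero)))
        (sumF-diagonalʳ (λ i → D (fsuc i)) (λ i → f (fsuc i)) m)

mulV-identity : ∀ {n} (v : Fin n → ℕ) i → mulV identity v i ≡ v i
mulV-identity v i = trans (sumF-diagonalˡ (λ _ → 1) v i) (*-identityˡ (v i))

arrow : ∀ {d} → ℕ → (β γ D : Fin d → ℕ) → Mat (suc d) (suc d) ℕ
arrow α β γ D fzero    fzero    = α
arrow α β γ D fzero    (fsuc l) = β l
arrow α β γ D (fsuc k) fzero    = γ k
arrow α β γ D (fsuc k) (fsuc l) = diagonal D k l

single : ℕ → Mat 1 1 ℕ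
single s _ _ = s

zeroMat : ∀ {a b} → Mat a b ℕ
zeroMat _ _ = 0

diagonal-*ˡ : ∀ {n} (D w : Fin n → ℕ) k l → D k * diagonal w k l ≡ diagonal (λ i → D i * w i) k l
diagonal-*ˡ D w fzero    fzero    = refl
diagonal-*ˡ D w fzero    (fsuc l) = *-zeroʳ (D fzero)
diagonal-*ˡ D w (fsuc k) fzero    = *-zeroʳ (D (fsuc k))
diagonal-*ˡ D w (fsuc k) (fsuc l) = diagonal-*ˡ (λ i → D (fsuc i)) (λ i → w (fsuc i)) k l

-- Congruences and isomorphisms of cokernels modulo q

module Congruence (q : ℕ) where

  infix 4 _≋_ _≋ₘ_

  _≋_ : ℕ → ℕ → Set
  x ≋ y = x ≡ y [mod q ]

  ≋-refl : ∀ {x} → x ≋ x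
  ≋-refl = 0 , 0 , refl

  ≋-reflexive : ∀ {x y} → x ≡ y → x ≋ y
  ≋-reflexive refl = ≋-refl

  ≋-sym : ∀ {x y} → x ≋ y → y ≋ x
  ≋-sym (a , b , e) = b , a , sym e

  ≋-trans : ∀ {x y z} → x ≋ y → y ≋ z → x ≋ z
  ≋-trans {x} {y} {z} (a , b , x≈y) (c , d , y≈z) = a + c , d + b , (begin
    x + (a + c) * q     ≡⟨ shift x a c q ⟩
    (x + a * q) + c * q ≡⟨ cong (_+ c * q) x≈y ⟩
    (y + b * q) + c * q ≡⟨ swap y b c q ⟩
    (y + c * q) + b * q ≡⟨ cong (_+ b * q) y≈z ⟩
    (z + d * q) + b * q ≡⟨ sym (shift z d b q) ⟩
    z + (d + b) * q     ∎)
    where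
    open ≡-Reasoning
    shift : ∀ x a c q → x + (a + c) * q ≡ (x + a * q) + c * q
    shift = solve-∀
    swap : ∀ y b c q → (y + b * q) + c * q ≡ (y + c * q) + b * q
    swap = solve-∀

  ≋-setoid : Setoid _ _
  ≋-setoid = record
    { Carrier = ℕ ; _≈_ = _≋_
    ; isEquivalence = record { refl = ≋-refl ; sym = ≋-sym ; trans = ≋-trans } }

  module ≋-Reasoning = SetoidReasoning ≋-setoid

  +-cong : ∀ {x y u v} → x ≋ y → u ≋ v → x + u ≋ y + v
  +-cong {x} {y} {u} {v} (a , b , x≈y) (c , d , u≈v) = a + c , b + d , (begin
    x + u + (a + c) * q       ≡⟨ regroup x u a c q ⟩
    (x + a * q) + (u + c * q) ≡⟨ cong₂ _+_ x≈y u≈v ⟩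
    (y + b * q) + (v + d * q) ≡⟨ sym (regroup y v b d q) ⟩
    y + v + (b + d) * q       ∎)
    where
    open ≡-Reasoning
    regroup : ∀ x u a c q → x + u + (a + c) * q ≡ (x + a * q) + (u + c * q)
    regroup = solve-∀

  *-congˡ : ∀ c {x y} → x ≋ y → c * x ≋ c * y
  *-congˡ c {x} {y} (a , b , x≈y) = c * a , c * b , (begin
    c * x + c * a * q ≡⟨ factor c x a q ⟩
    c * (x + a * q)   ≡⟨ cong (c *_) x≈y ⟩
    c * (y + b * q)   ≡⟨ sym (factor c y b q) ⟩
    c * y + c * b * q ∎)
    where
    open ≡-Reasoning
    factor : ∀ c x a q → c * x + c * a * q ≡ c * (x + a * q)
    factor = solve-∀

  *-congʳ : ∀ c {x y} → x ≋ y → x * c ≋ y * c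
  *-congʳ c {x} {y} x≈y =
    ≋-trans (≋-reflexive (*-comm x c)) (≋-trans (*-congˡ c x≈y) (≋-reflexive (*-comm c y)))

  *-cong : ∀ {x y u v} → x ≋ y → u ≋ v → x * u ≋ y * v
  *-cong {y = y} {u = u} x≈y u≈v = ≋-trans (*-congʳ u x≈y) (*-congˡ y u≈v)

  multiple≋0 : ∀ x → x * q ≋ 0
  multiple≋0 x = 0 , x , +-identityʳ (x * q)

  *-≋0ʳ : ∀ a {b} → b ≋ 0 → a * b ≋ 0
  *-≋0ʳ a b≈0 = ≋-trans (*-congˡ a b≈0) (≋-reflexive (*-zeroʳ a))

  sumF-cong≋ : ∀ n {f g : Fin n → ℕ} → (∀ i → f i ≋ g i) → sumF n f ≋ sumF n g
  sumF-cong≋ zero    f≈g = ≋-refl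
  sumF-cong≋ (suc n) f≈g = +-cong (f≈g fzero) (sumF-cong≋ n (λ i → f≈g (fsuc i)))

  _≋ₘ_ : ∀ {a b} → Mat a b ℕ → Mat a b ℕ → Set
  A ≋ₘ B = ∀ i j → A i j ≋ B i j

  mulV-congˡ : ∀ {a b} {A B : Mat a b ℕ} → A ≋ₘ B → ∀ v i → mulV A v i ≋ mulV B v i
  mulV-congˡ {b = b} A≈B v i = sumF-cong≋ b (λ j → *-congʳ (v j) (A≈B i j))

  mulV-congʳ : ∀ {a b} (A : Mat a b ℕ) {u v : Fin b → ℕ} → (∀ j → u j ≋ v j) →
    ∀ i → mulV A u i ≋ mulV A v i
  mulV-congʳ {b = b} A u≈v i = sumF-cong≋ b (λ j → *-congˡ (A i j) (u≈v j))

  diagonal-cong : ∀ {n} {D D' : Fin n → ℕ} → (∀ i → D i ≋ D' i) → diagonal D ≋ₘ diagonal D'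
  diagonal-cong D≈D' fzero    fzero    = D≈D' fzero
  diagonal-cong D≈D' fzero    (fsuc l) = ≋-refl
  diagonal-cong D≈D' (fsuc k) fzero    = ≋-refl
  diagonal-cong D≈D' (fsuc k) (fsuc l) = diagonal-cong (λ i → D≈D' (fsuc i)) k l

  arrow-cong : ∀ {d} {α α'} {β β' γ γ' D D' : Fin d → ℕ} → α ≋ α' → (∀ l → β l ≋ β' l) →
    (∀ l → γ l ≋ γ' l) → (∀ l → D l ≋ D' l) → arrow α β γ D ≋ₘ arrow α' β' γ' D'
  arrow-cong α≈α' β≈β' γ≈γ' D≈D' fzero    fzero    = α≈α'
  arrow-cong α≈α' β≈β' γ≈γ' D≈D' fzero    (fsuc l) = β≈β' l
  arrow-cong α≈α' β≈β' γ≈γ' D≈D' (fsuc k) fzero    = γ≈γ' k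
  arrow-cong α≈α' β≈β' γ≈γ' D≈D' (fsuc k) (fsuc l) = diagonal-cong D≈D' k l

  ≈cok-intro : ∀ {a b} (A : Mat a b ℕ) {v v' : Fin a → ℕ} (u : Fin b → ℕ) →
    (∀ i → v i + mulV A u i ≋ v' i) → ≈cok q A v v'
  ≈cok-intro A {v' = v'} u e = u , (λ _ → 0) , λ i →
    ≋-trans (e i) (≋-reflexive (sym (trans (cong (v' i +_) (mulV-zero A i)) (+-identityʳ (v' i)))))

  ≈cok-resp : ∀ {a b} (A : Mat a b ℕ) {v v' w w' : Fin a → ℕ} →
    (∀ i → v i ≋ w i) → (∀ i → v' i ≋ w' i) → ≈cok q A v v' → ≈cok q A w w'
  ≈cok-resp A v≈w v'≈w' (u , u' , e) = u , u' , λ i →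
    ≋-trans (+-cong (≋-sym (v≈w i)) ≋-refl) (≋-trans (e i) (+-cong (v'≈w' i) ≋-refl))

  ≈cok-trans : ∀ {a b} (A : Mat a b ℕ) {v v' v'' : Fin a → ℕ} →
    ≈cok q A v v' → ≈cok q A v' v'' → ≈cok q A v v''
  ≈cok-trans A {v} {v'} {v''} (u , u' , e) (t , t' , e') =
    (λ j → u j + t j) , (λ j → u' j + t' j) , λ i → begin
      v i + mulV A (λ j → u j + t j) i       ≡⟨ cong (v i +_) (mulV-+ A u t i) ⟩
      v i + (mulV A u i + mulV A t i)        ≡⟨ sym (+-assoc (v i) _ _) ⟩
      v i + mulV A u i + mulV A t i          ≈⟨ +-cong (e i) ≋-refl ⟩
      v' i + mulV A u' i + mulV A t i        ≡⟨ +-right-comm (v' i) _ _ ⟩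
      v' i + mulV A t i + mulV A u' i        ≈⟨ +-cong (e' i) ≋-refl ⟩
      v'' i + mulV A t' i + mulV A u' i      ≡⟨ +-right-comm (v'' i) _ _ ⟩
      v'' i + mulV A u' i + mulV A t' i      ≡⟨ +-assoc (v'' i) _ _ ⟩
      v'' i + (mulV A u' i + mulV A t' i)    ≡⟨ cong (v'' i +_) (sym (mulV-+ A u' t' i)) ⟩
      v'' i + mulV A (λ j → u' j + t' j) i   ∎
    where open ≋-Reasoning

  MapsImage : ∀ {a a' b b'} → Mat b a ℕ → Mat a a' ℕ → Mat b b' ℕ → Set
  MapsImage {a' = a'} {b' = b'} F A B =
    ∀ (u : Fin a' → ℕ) → Σ (Fin b' → ℕ) λ u' → ∀ i → mulV F (mulV A u) i ≋ mulV B u' i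

  mulV-resp-≈cok : ∀ {a a' b b'} {F : Mat b a ℕ} {A : Mat a a' ℕ} {B : Mat b b' ℕ} →
    MapsImage F A B → ∀ v v' → ≈cok q A v v' → ≈cok q B (mulV F v) (mulV F v')
  mulV-resp-≈cok {F = F} {A} {B} FA⊆B v v' (u , u' , e) with FA⊆B u | FA⊆B u'
  ... | t , Fu≈Bt | t' , Fu'≈Bt' = t , t' , λ i → begin
    mulV F v i + mulV B t i            ≈⟨ +-cong ≋-refl (≋-sym (Fu≈Bt i)) ⟩
    mulV F v i + mulV F (mulV A u) i   ≡⟨ sym (mulV-+ F v (mulV A u) i) ⟩
    mulV F (λ j → v j + mulV A u j) i  ≈⟨ mulV-congʳ F e i ⟩
    mulV F (λ j → v' j + mulV A u' j) i ≡⟨ mulV-+ F v' (mulV A u') i ⟩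
    mulV F v' i + mulV F (mulV A u') i ≈⟨ +-cong ≋-refl (Fu'≈Bt' i) ⟩
    mulV F v' i + mulV B t' i          ∎
    where open ≋-Reasoning

  mapsImage-⊗ : ∀ {a a' b b'} {F : Mat b a ℕ} {A : Mat a a' ℕ} {B : Mat b b' ℕ} (K : Mat b' a' ℕ) →
    F ⊗ A ≋ₘ B ⊗ K → MapsImage F A B
  mapsImage-⊗ {F = F} {A} {B} K FA≈BK u = mulV K u , λ i → begin
    mulV F (mulV A u) i ≡⟨ sym (mulV-⊗ F A u i) ⟩
    mulV (F ⊗ A) u i    ≈⟨ mulV-congˡ FA≈BK u i ⟩
    mulV (B ⊗ K) u i    ≡⟨ mulV-⊗ B K u i ⟩
    mulV B (mulV K u) i ∎
    where open ≋-Reasoning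

  ≈cok-homotopy : ∀ {a a' b} {A : Mat a a' ℕ} {F : Mat b a ℕ} {G : Mat a b ℕ} (U : Mat a' a ℕ) →
    G ⊗ F ⊕ A ⊗ U ≋ₘ identity → ∀ v → ≈cok q A (mulV G (mulV F v)) v
  ≈cok-homotopy {A = A} {F} {G} U GF+AU≈I v = ≈cok-intro A (mulV U v) λ i → begin
    mulV G (mulV F v) i + mulV A (mulV U v) i ≡⟨ sym (cong₂ _+_ (mulV-⊗ G F v i) (mulV-⊗ A U v i)) ⟩
    mulV (G ⊗ F) v i + mulV (A ⊗ U) v i       ≡⟨ sym (mulV-⊕ (G ⊗ F) (A ⊗ U) v i) ⟩
    mulV (G ⊗ F ⊕ A ⊗ U) v i                  ≈⟨ mulV-congˡ GF+AU≈I v i ⟩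
    mulV identity v i                         ≡⟨ mulV-identity v i ⟩
    v i                                       ∎
    where open ≋-Reasoning

  -- a record rather than CokIso itself, so that both matrices can be inferred
  record _≅_ {a a' b b'} (A : Mat a a' ℕ) (B : Mat b b' ℕ) : Set where
    constructor mk≅
    field cokIso : CokIso q A B

  -- F and G intertwine the two presentations (via K₁ and K₂) and are mutually inverse on the
  -- cokernels up to the homotopies U₁ and U₂
  ≅-intro : ∀ {a a' b b'} {A : Mat a a' ℕ} {B : Mat b b' ℕ}
    (F : Mat b a ℕ) (G : Mat a b ℕ) (K₁ : Mat b' a' ℕ) (K₂ : Mat a' b' ℕ)
    (U₁ : Mat a' a ℕ) (U₂ : Mat b' b ℕ) →
    F ⊗ A ≋ₘ B ⊗ K₁ → G ⊗ B ≋ₘ A ⊗ K₂ →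
    G ⊗ F ⊕ A ⊗ U₁ ≋ₘ identity → F ⊗ G ⊕ B ⊗ U₂ ≋ₘ identity → A ≅ B
  ≅-intro {A = A} {B} F G K₁ K₂ U₁ U₂ FA≈BK₁ GB≈AK₂ GF≃I FG≃I = mk≅ (
    F , G ,
    mulV-resp-≈cok {F = F} {A} {B} (mapsImage-⊗ {F = F} {A} {B} K₁ FA≈BK₁) ,
    mulV-resp-≈cok {F = G} {B} {A} (mapsImage-⊗ {F = G} {B} {A} K₂ GB≈AK₂) ,
    ≈cok-homotopy {A = A} {F} {G} U₁ GF≃I , ≈cok-homotopy {A = B} {G} {F} U₂ FG≃I)

  ≅-sameImage : ∀ {a a' b'} (A : Mat a a' ℕ) (B : Mat a b' ℕ) (K₁ : Mat b' a' ℕ) (K₂ : Mat a' b' ℕ) →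
    A ≋ₘ B ⊗ K₁ → B ≋ₘ A ⊗ K₂ → A ≅ B
  ≅-sameImage {a = a} A B K₁ K₂ A≈BK₁ B≈AK₂ =
    ≅-intro identity identity K₁ K₂ zeroMat zeroMat
      (λ i j → ≋-trans (≋-reflexive (identity-⊗ A i j)) (A≈BK₁ i j))
      (λ i j → ≋-trans (≋-reflexive (identity-⊗ B i j)) (B≈AK₂ i j))
      (λ i j → ≋-reflexive (identity⊗identity⊕zero A i j))
      (λ i j → ≋-reflexive (identity⊗identity⊕zero B i j))
    where
    identity-⊗ : ∀ {c} (M : Mat a c ℕ) i j → (identity ⊗ M) i j ≡ M i j
    identity-⊗ M i j = trans (sumF-diagonalˡ (λ _ → 1) (λ k → M k j) i) (*-identityˡ (M i j))
    identity⊗identity⊕zero : ∀ {c} (M : Mat a c ℕ) i j →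
      (identity ⊗ identity ⊕ M ⊗ zeroMat) i j ≡ identity i j
    identity⊗identity⊕zero M i j =
      trans (cong₂ _+_ (identity-⊗ identity i j) (mulV-zero M i)) (+-identityʳ (identity i j))

  ≅-trans : ∀ {a a' b b' c c'} {A : Mat a a' ℕ} {B : Mat b b' ℕ} {C : Mat c c' ℕ} → A ≅ B → B ≅ C → A ≅ C
  ≅-trans {A = A} {B} {C} (mk≅ (F , G , pushF , pushG , GF≈id , FG≈id))
                          (mk≅ (F' , G' , pushF' , pushG' , G'F'≈id , F'G'≈id)) = mk≅ (
    F' ⊗ F , G ⊗ G' ,
    (λ v v' v≈v' → ≈cok-resp C (sym-⊗ F' F v) (sym-⊗ F' F v') (pushF' _ _ (pushF v v' v≈v'))) ,
    (λ w w' w≈w' → ≈cok-resp A (sym-⊗ G G' w) (sym-⊗ G G' w') (pushG _ _ (pushG' w w' w≈w'))) ,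
    (λ v → ≈cok-trans A (≈cok-resp A (sym-⊗⊗ G G' F' F v) (λ _ → ≋-refl) (pushG _ _ (G'F'≈id (mulV F v))))
                        (GF≈id v)) ,
    (λ w → ≈cok-trans C (≈cok-resp C (sym-⊗⊗ F' F G G' w) (λ _ → ≋-refl) (pushF' _ _ (FG≈id (mulV G' w))))
                        (F'G'≈id w)))
    where
    sym-⊗ : ∀ {k l m} (M : Mat k l ℕ) (N : Mat l m ℕ) v i → mulV M (mulV N v) i ≋ mulV (M ⊗ N) v i
    sym-⊗ M N v i = ≋-reflexive (sym (mulV-⊗ M N v i))
    sym-⊗⊗ : ∀ {k l m n o} (M : Mat k l ℕ) (M' : Mat l m ℕ) (N : Mat m n ℕ) (N' : Mat n o ℕ) v i →
      mulV M (mulV M' (mulV N (mulV N' v))) i ≋ mulV (M ⊗ M') (mulV (N ⊗ N') v) i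
    sym-⊗⊗ M M' N N' v i =
      ≋-trans (mulV-congʳ M (mulV-congʳ M' (sym-⊗ N N' v)) i) (sym-⊗ M M' (mulV (N ⊗ N') v) i)

-- Eliminating the unit part of the tail of an arrowhead matrix

module Arrowhead (q : ℕ) {{_ : NonZero q}} where
  open Congruence q

  -- entries are natural numbers, so −1 is represented by q-1
  q-1 : ℕ
  q-1 = q ∸ 1

  q-1-inverse : ∀ x → x + q-1 * x ≋ 0
  q-1-inverse x = ≋-trans (≋-reflexive (begin
    x + q-1 * x   ≡⟨ cong (_+ q-1 * x) (sym (*-identityˡ x)) ⟩
    1 * x + q-1 * x ≡⟨ sym (*-distribʳ-+ x 1 q-1) ⟩
    (1 + q-1) * x ≡⟨ cong (_* x) (m+[n∸m]≡n (>-nonZero⁻¹ q)) ⟩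
    q * x         ≡⟨ *-comm q x ⟩
    x * q         ∎)) (multiple≋0 x)
    where open ≡-Reasoning

  +≋0⇒≋q-1* : ∀ {x y} → x + y ≋ 0 → x ≋ q-1 * y
  +≋0⇒≋q-1* {x} {y} x+y≈0 = begin
    x                   ≡⟨ sym (+-identityʳ x) ⟩
    x + 0               ≈⟨ +-cong ≋-refl (≋-sym (q-1-inverse y)) ⟩
    x + (y + q-1 * y)   ≡⟨ sym (+-assoc x y (q-1 * y)) ⟩
    x + y + q-1 * y     ≈⟨ +-cong x+y≈0 ≋-refl ⟩
    q-1 * y             ∎
    where open ≋-Reasoning

  q-1²≋1 : q-1 * q-1 ≋ 1
  q-1²≋1 = ≋-sym (+≋0⇒≋q-1* (≋-trans (≋-reflexive (cong (1 +_) (sym (*-identityʳ q-1)))) (q-1-inverse 1)))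

  schur : ∀ {d} → ℕ → (β γ w : Fin d → ℕ) → ℕ
  schur {d} α β γ w = α + sumF d (λ l → β l * (q-1 * (w l * γ l)))

  schur-zeroRow : ∀ {d} α (γ w : Fin d → ℕ) → schur α (λ _ → 0) γ w ≡ α
  schur-zeroRow {d} α γ w = trans (cong (α +_) (sumF-zero d)) (+-identityʳ α)

  absorb : ∀ x {u} → u ≋ 1 → x + q-1 * (x * u) ≋ 0
  absorb x {u} u≈1 = ≋-trans (+-cong ≋-refl (*-congˡ q-1 (*-congˡ x u≈1)))
                             (≋-trans (≋-reflexive (cong (λ y → x + q-1 * y) (*-identityʳ x))) (q-1-inverse x))

  -- column l of the arrowhead matrix makes e_l = −w_l β_l e_0 in the cokernel, so only e_0 survives,
  -- subject to the Schur complement of the tail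
  module EliminateTail {d} (α : ℕ) (β γ D w : Fin d → ℕ) (Dw≈1 : ∀ l → D l * w l ≋ 1) where

    A : Mat (suc d) (suc d) ℕ
    A = arrow α β γ D

    S : ℕ
    S = schur α β γ w

    F : Mat 1 (suc d) ℕ
    F _ fzero    = 1
    F _ (fsuc l) = q-1 * (β l * w l)

    G : Mat (suc d) 1 ℕ
    G fzero    _ = 1
    G (fsuc _) _ = 0

    K₁ : Mat 1 (suc d) ℕ
    K₁ _ fzero    = 1
    K₁ _ (fsuc _) = 0

    K₂ : Mat (suc d) 1 ℕ
    K₂ fzero    _ = 1
    K₂ (fsuc l) _ = q-1 * (w l * γ l)

    FA≈SK₁ : F ⊗ A ≋ₘ single S ⊗ K₁
    FA≈SK₁ _ fzero = ≋-reflexive (begin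
      1 * α + sumF d (λ l → q-1 * (β l * w l) * γ l)
        ≡⟨ cong₂ _+_ (*-identityˡ α) (sumF-cong d λ l → regroup (β l) (w l) (γ l) q-1) ⟩
      S ≡⟨ sym (trans (+-identityʳ (S * 1)) (*-identityʳ S)) ⟩
      S * 1 + 0 ∎)
      where
      open ≡-Reasoning
      regroup : ∀ b w g r → r * (b * w) * g ≡ b * (r * (w * g))
      regroup = solve-∀
    FA≈SK₁ _ (fsuc m) = begin
      1 * β m + sumF d (λ l → q-1 * (β l * w l) * diagonal D l m)
        ≡⟨ cong₂ _+_ (*-identityˡ (β m)) (sumF-diagonalʳ D (λ l → q-1 * (β l * w l)) m) ⟩
      β m + q-1 * (β m * w m) * D m   ≡⟨ regroup (β m) (w m) (D m) q-1 ⟩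
      β m + q-1 * (β m * (D m * w m)) ≈⟨ absorb (β m) (Dw≈1 m) ⟩
      0                               ≡⟨ sym (cong (_+ 0) (*-zeroʳ S)) ⟩
      S * 0 + 0                       ∎
      where
      open ≋-Reasoning
      regroup : ∀ b w D r → b + r * (b * w) * D ≡ b + r * (b * (D * w))
      regroup = solve-∀

    GS≈AK₂ : G ⊗ single S ≋ₘ A ⊗ K₂
    GS≈AK₂ fzero    _ = ≋-reflexive (trans (trans (+-identityʳ (1 * S)) (*-identityˡ S))
                                           (sym (cong (_+ _) (*-identityʳ α))))
    GS≈AK₂ (fsuc k) _ = ≋-sym (begin
      γ k * 1 + sumF d (λ l → diagonal D k l * (q-1 * (w l * γ l)))
        ≡⟨ cong (γ k * 1 +_) (sumF-diagonalˡ D (λ l → q-1 * (w l * γ l)) k) ⟩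
      γ k * 1 + D k * (q-1 * (w k * γ k)) ≡⟨ regroup (γ k) (w k) (D k) q-1 ⟩
      γ k + q-1 * (γ k * (D k * w k))     ≈⟨ absorb (γ k) (Dw≈1 k) ⟩
      0                                   ∎)
      where
      open ≋-Reasoning
      regroup : ∀ g w D r → g * 1 + D * (r * (w * g)) ≡ g + r * (g * (D * w))
      regroup = solve-∀

    U₁ : Mat (suc d) (suc d) ℕ
    U₁ = arrow 0 (λ _ → 0) (λ _ → 0) w

    GF+AU≈I : G ⊗ F ⊕ A ⊗ U₁ ≋ₘ identity
    GF+AU≈I fzero fzero = ≋-reflexive (cong (1 +_) (cong₂ _+_ (*-zeroʳ α) (sumF-*-zero d β)))
    GF+AU≈I fzero (fsuc m) = begin
      1 * (q-1 * (β m * w m)) + 0 + (α * 0 + sumF d (λ l → β l * diagonal w l m))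
        ≡⟨ cong₂ _+_ (trans (+-identityʳ (1 * (q-1 * (β m * w m)))) (*-identityˡ (q-1 * (β m * w m))))
                     (cong (α * 0 +_) (sumF-diagonalʳ w β m)) ⟩
      q-1 * (β m * w m) + (α * 0 + β m * w m) ≡⟨ cong (q-1 * (β m * w m) +_) (cong (_+ β m * w m) (*-zeroʳ α)) ⟩
      q-1 * (β m * w m) + β m * w m           ≡⟨ +-comm (q-1 * (β m * w m)) (β m * w m) ⟩
      β m * w m + q-1 * (β m * w m)           ≈⟨ q-1-inverse (β m * w m) ⟩
      0                                       ∎
      where open ≋-Reasoning
    GF+AU≈I (fsuc k) fzero = ≋-reflexive (cong₂ _+_ (*-zeroʳ (γ k)) (sumF-*-zero d (diagonal D k)))
    GF+AU≈I (fsuc k) (fsuc m) = begin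
      γ k * 0 + sumF d (λ l → diagonal D k l * diagonal w l m)
        ≡⟨ cong₂ _+_ (*-zeroʳ (γ k)) (sumF-diagonalˡ D (λ l → diagonal w l m) k) ⟩
      D k * diagonal w k m                    ≡⟨ diagonal-*ˡ D w k m ⟩
      diagonal (λ i → D i * w i) k m          ≈⟨ diagonal-cong Dw≈1 k m ⟩
      diagonal (λ _ → 1) k m                  ∎
      where open ≋-Reasoning

    FG+SU≈I : F ⊗ G ⊕ single S ⊗ zeroMat ≋ₘ identity
    FG+SU≈I fzero fzero = ≋-reflexive
      (cong₂ _+_ (cong (1 +_) (sumF-*-zero d (λ l → q-1 * (β l * w l)))) (cong (_+ 0) (*-zeroʳ S)))

  arrow-eliminateTail : ∀ {d} α (β γ D w : Fin d → ℕ) → (∀ l → D l * w l ≋ 1) →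
    arrow α β γ D ≅ single (schur α β γ w)
  arrow-eliminateTail α β γ D w Dw≈1 =
    ≅-intro {A = A} {B = single S} F G K₁ K₂ U₁ zeroMat FA≈SK₁ GS≈AK₂ GF+AU≈I FG+SU≈I
    where open EliminateTail α β γ D w Dw≈1

  -- as above, but e_{k₀} survives as a second generator; w k₀ ≋ 0 keeps it out of the Schur complement
  module EliminateTailExcept {d} (α : ℕ) (β γ D w : Fin d → ℕ) (k₀ : Fin d)
    (w₀≈0 : w k₀ ≋ 0) (Dw≈1 : ∀ l → ¬ l ≡ k₀ → D l * w l ≋ 1) where

    A : Mat (suc d) (suc d) ℕ
    A = arrow α β γ D

    S : ℕ
    S = schur α β γ w

    B : Mat 2 2 ℕ
    B = arrow S (λ _ → β k₀) (λ _ → γ k₀) (λ _ → D k₀)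

    F : Mat 2 (suc d) ℕ
    F fzero    fzero    = 1
    F fzero    (fsuc l) = q-1 * (β l * w l)
    F (fsuc _) fzero    = 0
    F (fsuc _) (fsuc l) = identity k₀ l

    G : Mat (suc d) 2 ℕ
    G fzero    fzero    = 1
    G fzero    (fsuc _) = 0
    G (fsuc l) fzero    = 0
    G (fsuc l) (fsuc _) = identity l k₀

    K₁ : Mat 2 (suc d) ℕ
    K₁ fzero    fzero    = 1
    K₁ fzero    (fsuc _) = 0
    K₁ (fsuc _) fzero    = 0
    K₁ (fsuc _) (fsuc m) = identity k₀ m

    K₂ : Mat (suc d) 2 ℕ
    K₂ fzero    fzero    = 1
    K₂ fzero    (fsuc _) = 0
    K₂ (fsuc l) fzero    = q-1 * (w l * γ l)
    K₂ (fsuc l) (fsuc _) = identity l k₀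

    U₁ : Mat (suc d) (suc d) ℕ
    U₁ = arrow 0 (λ _ → 0) (λ _ → 0) w

    absorb₀ : ∀ x {u} → u ≋ 0 → x + q-1 * (x * u) ≋ x
    absorb₀ x u≈0 = ≋-trans (+-cong ≋-refl (*-≋0ʳ q-1 (*-≋0ʳ x u≈0))) (≋-reflexive (+-identityʳ x))

    identity-diag : ∀ (k : Fin d) → identity k k ≡ 1
    identity-diag = diagonal-diag (λ _ → 1)

    identity-offDiag : ∀ {k l : Fin d} → ¬ k ≡ l → identity k l ≡ 0
    identity-offDiag = diagonal-offDiag (λ _ → 1)

    FA≈BK₁ : F ⊗ A ≋ₘ B ⊗ K₁
    FA≈BK₁ fzero fzero = ≋-reflexive (begin
      1 * α + sumF d (λ l → q-1 * (β l * w l) * γ l)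
        ≡⟨ cong₂ _+_ (*-identityˡ α) (sumF-cong d λ l → regroup (β l) (w l) (γ l) q-1) ⟩
      S ≡⟨ sym (trans (cong₂ _+_ (*-identityʳ S) (trans (+-identityʳ _) (*-zeroʳ (β k₀)))) (+-identityʳ S)) ⟩
      S * 1 + (β k₀ * 0 + 0) ∎)
      where
      open ≡-Reasoning
      regroup : ∀ b w g r → r * (b * w) * g ≡ b * (r * (w * g))
      regroup = solve-∀
    FA≈BK₁ fzero (fsuc m) = begin
      1 * β m + sumF d (λ l → q-1 * (β l * w l) * diagonal D l m)
        ≡⟨ cong₂ _+_ (*-identityˡ (β m)) (sumF-diagonalʳ D (λ l → q-1 * (β l * w l)) m) ⟩
      β m + q-1 * (β m * w m) * D m   ≡⟨ regroup (β m) (w m) (D m) q-1 ⟩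
      β m + q-1 * (β m * (D m * w m)) ≈⟨ byCases m ⟩
      β k₀ * identity k₀ m            ≡⟨ sym (cong₂ _+_ (*-zeroʳ S) (+-identityʳ _)) ⟩
      S * 0 + (β k₀ * identity k₀ m + 0) ∎
      where
      open ≋-Reasoning
      regroup : ∀ b w D r → b + r * (b * w) * D ≡ b + r * (b * (D * w))
      regroup = solve-∀
      byCases : ∀ m → β m + q-1 * (β m * (D m * w m)) ≋ β k₀ * identity k₀ m
      byCases m with m ≟ k₀
      ... | yes refl = ≋-trans (absorb₀ (β m) (*-≋0ʳ (D m) w₀≈0))
                               (≋-reflexive (sym (trans (cong (β m *_) (identity-diag m)) (*-identityʳ (β m)))))
      ... | no m≢k₀ = ≋-trans (absorb (β m) (Dw≈1 m m≢k₀))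
                              (≋-reflexive (sym (trans (cong (β k₀ *_) (identity-offDiag (λ e → m≢k₀ (sym e))))
                                                       (*-zeroʳ (β k₀)))))
    FA≈BK₁ (fsuc fzero) fzero = ≋-reflexive (begin
      sumF d (λ l → identity k₀ l * γ l) ≡⟨ sumF-diagonalˡ (λ _ → 1) γ k₀ ⟩
      1 * γ k₀                           ≡⟨ trans (*-identityˡ (γ k₀)) (sym (*-identityʳ (γ k₀))) ⟩
      γ k₀ * 1
        ≡⟨ sym (trans (cong (γ k₀ * 1 +_) (cong (_+ 0) (*-zeroʳ (D k₀)))) (+-identityʳ _)) ⟩
      γ k₀ * 1 + (D k₀ * 0 + 0)          ∎)
      where open ≡-Reasoning
    FA≈BK₁ (fsuc fzero) (fsuc m) = begin
      sumF d (λ l → identity k₀ l * diagonal D l m) ≡⟨ sumF-diagonalˡ (λ _ → 1) (λ l → diagonal D l m) k₀ ⟩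
      1 * diagonal D k₀ m                ≡⟨ *-identityˡ _ ⟩
      diagonal D k₀ m                    ≈⟨ diagonal-cong (λ i → ≋-reflexive (sym (*-identityʳ (D i)))) k₀ m ⟩
      diagonal (λ i → D i * 1) k₀ m      ≡⟨ sym (diagonal-*ˡ D (λ _ → 1) k₀ m) ⟩
      D k₀ * identity k₀ m               ≡⟨ sym (cong₂ _+_ (*-zeroʳ (γ k₀)) (+-identityʳ _)) ⟩
      γ k₀ * 0 + (D k₀ * identity k₀ m + 0) ∎
      where open ≋-Reasoning

    identity-select : ∀ (f : Fin d → ℕ) k → identity k k₀ * f k₀ ≡ f k * identity k k₀
    identity-select f k with k ≟ k₀
    ... | yes refl = *-comm (identity k k) (f k)
    ... | no k≢k₀  = trans (cong (_* f k₀) (identity-offDiag k≢k₀))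
                           (sym (trans (cong (f k *_) (identity-offDiag k≢k₀)) (*-zeroʳ (f k))))

    GB≈AK₂ : G ⊗ B ≋ₘ A ⊗ K₂
    GB≈AK₂ fzero fzero = ≋-reflexive (trans (trans (+-identityʳ (1 * S)) (*-identityˡ S))
                                            (sym (cong (_+ _) (*-identityʳ α))))
    GB≈AK₂ fzero (fsuc fzero) = ≋-reflexive (begin
      1 * β k₀ + 0   ≡⟨ trans (+-identityʳ _) (trans (*-identityˡ (β k₀)) (sym (*-identityʳ (β k₀)))) ⟩
      β k₀ * 1       ≡⟨ sym (sumF-diagonalʳ (λ _ → 1) β k₀) ⟩
      sumF d (λ l → β l * identity l k₀)
        ≡⟨ sym (cong (_+ sumF d (λ l → β l * identity l k₀)) (*-zeroʳ α)) ⟩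
      α * 0 + sumF d (λ l → β l * identity l k₀)    ∎)
      where open ≡-Reasoning
    GB≈AK₂ (fsuc k) fzero = ≋-sym (begin
      γ k * 1 + sumF d (λ l → diagonal D k l * (q-1 * (w l * γ l)))
        ≡⟨ cong (γ k * 1 +_) (sumF-diagonalˡ D (λ l → q-1 * (w l * γ l)) k) ⟩
      γ k * 1 + D k * (q-1 * (w k * γ k)) ≡⟨ regroup (γ k) (w k) (D k) q-1 ⟩
      γ k + q-1 * (γ k * (D k * w k))     ≈⟨ byCases k ⟩
      identity k k₀ * γ k₀ + 0            ∎)
      where
      open ≋-Reasoning
      regroup : ∀ g w D r → g * 1 + D * (r * (w * g)) ≡ g + r * (g * (D * w))
      regroup = solve-∀
      byCases : ∀ k → γ k + q-1 * (γ k * (D k * w k)) ≋ identity k k₀ * γ k₀ + 0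
      byCases k with k ≟ k₀
      ... | yes refl = ≋-trans (absorb₀ (γ k) (*-≋0ʳ (D k) w₀≈0))
                               (≋-reflexive (sym (trans (+-identityʳ _)
                                 (trans (cong (_* γ k) (identity-diag k)) (*-identityˡ (γ k))))))
      ... | no k≢k₀ = ≋-trans (absorb (γ k) (Dw≈1 k k≢k₀))
                              (≋-reflexive (sym (trans (+-identityʳ _) (cong (_* γ k₀) (identity-offDiag k≢k₀)))))
    GB≈AK₂ (fsuc k) (fsuc fzero) = ≋-reflexive (begin
      identity k k₀ * D k₀ + 0  ≡⟨ trans (+-identityʳ _) (identity-select D k) ⟩
      D k * identity k k₀       ≡⟨ sym (sumF-diagonalˡ D (λ l → identity l k₀) k) ⟩
      sumF d (λ l → diagonal D k l * identity l k₀)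
        ≡⟨ sym (cong (_+ sumF d (λ l → diagonal D k l * identity l k₀)) (*-zeroʳ (γ k))) ⟩
      γ k * 0 + sumF d (λ l → diagonal D k l * identity l k₀) ∎)
      where open ≡-Reasoning

    tailBlock : ∀ k m → identity k k₀ * identity k₀ m + D k * diagonal w k m ≋ identity k m
    tailBlock k m with k ≟ m
    tailBlock k .k | yes refl with k ≟ k₀
    ... | yes refl = begin
      identity k k * identity k k + D k * diagonal w k k
        ≡⟨ cong₂ _+_ (cong₂ _*_ (identity-diag k) (identity-diag k)) (cong (D k *_) (diagonal-diag w k)) ⟩
      1 + D k * w k ≈⟨ +-cong ≋-refl (*-≋0ʳ (D k) w₀≈0) ⟩
      1 + 0         ≡⟨ sym (identity-diag k) ⟩
      identity k k  ∎
      where open ≋-Reasoning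
    ... | no k≢k₀ = begin
      identity k k₀ * identity k₀ k + D k * diagonal w k k
        ≡⟨ cong₂ _+_ (cong (_* identity k₀ k) (identity-offDiag k≢k₀)) (cong (D k *_) (diagonal-diag w k)) ⟩
      D k * w k     ≈⟨ Dw≈1 k k≢k₀ ⟩
      1             ≡⟨ sym (identity-diag k) ⟩
      identity k k  ∎
      where open ≋-Reasoning
    tailBlock k m | no k≢m = ≋-reflexive (begin
      identity k k₀ * identity k₀ m + D k * diagonal w k m
        ≡⟨ cong₂ _+_ (through k₀) (trans (cong (D k *_) (diagonal-offDiag w k≢m)) (*-zeroʳ (D k))) ⟩
      0             ≡⟨ sym (identity-offDiag k≢m) ⟩
      identity k m  ∎)
      where
      open ≡-Reasoning
      through : ∀ l → identity k l * identity l m ≡ 0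
      through l with k ≟ l
      ... | yes refl = trans (cong (identity k k *_) (identity-offDiag k≢m)) (*-zeroʳ (identity k k))
      ... | no k≢l   = cong (_* identity l m) (identity-offDiag k≢l)

    GF+AU≈I : G ⊗ F ⊕ A ⊗ U₁ ≋ₘ identity
    GF+AU≈I fzero fzero = ≋-reflexive (cong (1 +_) (cong₂ _+_ (*-zeroʳ α) (sumF-*-zero d β)))
    GF+AU≈I fzero (fsuc m) = begin
      1 * (q-1 * (β m * w m)) + 0 + (α * 0 + sumF d (λ l → β l * diagonal w l m))
        ≡⟨ cong₂ _+_ (trans (+-identityʳ (1 * (q-1 * (β m * w m)))) (*-identityˡ (q-1 * (β m * w m))))
                     (cong₂ _+_ (*-zeroʳ α) (sumF-diagonalʳ w β m)) ⟩
      q-1 * (β m * w m) + β m * w m ≡⟨ +-comm (q-1 * (β m * w m)) (β m * w m) ⟩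
      β m * w m + q-1 * (β m * w m) ≈⟨ q-1-inverse (β m * w m) ⟩
      0                             ∎
      where open ≋-Reasoning
    GF+AU≈I (fsuc k) fzero = ≋-reflexive
      (cong₂ _+_ (trans (+-identityʳ _) (*-zeroʳ (identity k k₀)))
                 (cong₂ _+_ (*-zeroʳ (γ k)) (sumF-*-zero d (diagonal D k))))
    GF+AU≈I (fsuc k) (fsuc m) = begin
      identity k k₀ * identity k₀ m + 0 + (γ k * 0 + sumF d (λ l → diagonal D k l * diagonal w l m))
        ≡⟨ cong₂ _+_ (+-identityʳ _) (cong₂ _+_ (*-zeroʳ (γ k)) (sumF-diagonalˡ D (λ l → diagonal w l m) k)) ⟩
      identity k k₀ * identity k₀ m + D k * diagonal w k m ≈⟨ tailBlock k m ⟩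
      identity k m                                         ∎
      where open ≋-Reasoning

    FG+BU≈I : F ⊗ G ⊕ B ⊗ zeroMat ≋ₘ identity
    FG+BU≈I i j = ≋-trans (≋-reflexive (trans (cong ((F ⊗ G) i j +_) (sumF-*-zero 2 (B i))) (+-identityʳ _)))
                          (FG≈I i j)
      where
      FG≈I : F ⊗ G ≋ₘ identity
      FG≈I fzero fzero = ≋-reflexive (cong (1 +_) (sumF-*-zero d (λ l → q-1 * (β l * w l))))
      FG≈I fzero (fsuc fzero) = begin
        sumF d (λ l → q-1 * (β l * w l) * identity l k₀)
          ≡⟨ sumF-diagonalʳ (λ _ → 1) (λ l → q-1 * (β l * w l)) k₀ ⟩
        q-1 * (β k₀ * w k₀) * 1 ≈⟨ *-congʳ 1 (*-≋0ʳ q-1 (*-≋0ʳ (β k₀) w₀≈0)) ⟩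
        0                       ∎
        where open ≋-Reasoning
      FG≈I (fsuc fzero) fzero = ≋-reflexive (sumF-*-zero d (identity k₀))
      FG≈I (fsuc fzero) (fsuc fzero) = ≋-reflexive
        (trans (sumF-diagonalˡ (λ _ → 1) (λ l → identity l k₀) k₀) (trans (*-identityˡ _) (identity-diag k₀)))

  arrow-eliminateTailExcept : ∀ {d} α (β γ D w : Fin d → ℕ) (k₀ : Fin d) →
    w k₀ ≋ 0 → (∀ l → ¬ l ≡ k₀ → D l * w l ≋ 1) →
    arrow α β γ D ≅ arrow (schur α β γ w) (λ _ → β k₀) (λ _ → γ k₀) (λ _ → D k₀)
  arrow-eliminateTailExcept α β γ D w k₀ w₀≈0 Dw≈1 =
    ≅-intro {A = A} {B = B} F G K₁ K₂ U₁ zeroMat FA≈BK₁ GB≈AK₂ GF+AU≈I FG+BU≈I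
    where open EliminateTailExcept α β γ D w k₀ w₀≈0 Dw≈1

module SmallCokernels (q : ℕ) where
  open Congruence q

  ≋ₘ⇒≅ : ∀ {a b} {A B : Mat a b ℕ} → A ≋ₘ B → A ≅ B
  ≋ₘ⇒≅ {A = A} {B} A≈B =
    ≅-sameImage A B identity identity (λ i j → ≋-trans (A≈B i j) (≋-reflexive (sym (⊗-identity B i j))))
                                       (λ i j → ≋-trans (≋-sym (A≈B i j)) (≋-reflexive (sym (⊗-identity A i j))))
    where
    ⊗-identity : (M : Mat _ _ ℕ) → ∀ i j → (M ⊗ identity) i j ≡ M i j
    ⊗-identity M i j = trans (sumF-diagonalʳ (λ _ → 1) (M i) j) (*-identityʳ (M i j))

  ≅-associates : ∀ (A B : Mat 1 1 ℕ) h h' →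
    A fzero fzero ≋ B fzero fzero * h → B fzero fzero ≋ A fzero fzero * h' → A ≅ B
  ≅-associates A B h h' A≈Bh B≈Ah' = ≅-sameImage A B (single h) (single h')
    (λ { fzero fzero → ≋-trans A≈Bh (≋-reflexive (sym (+-identityʳ _))) })
    (λ { fzero fzero → ≋-trans B≈Ah' (≋-reflexive (sym (+-identityʳ _))) })

  arrow-swapColumns : ∀ α β γ δ →
    arrow α (λ _ → β) (λ _ → γ) (λ _ → δ) ≅ arrow β (λ _ → α) (λ _ → δ) (λ _ → γ)
  arrow-swapColumns α β γ δ =
    ≅-sameImage (arrow α (λ _ → β) (λ _ → γ) (λ _ → δ)) (arrow β (λ _ → α) (λ _ → δ) (λ _ → γ))
                swap swap
    (λ { fzero fzero → second α β ; fzero (fsuc fzero) → first β α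
       ; (fsuc fzero) fzero → second γ δ ; (fsuc fzero) (fsuc fzero) → first δ γ })
    (λ { fzero fzero → second β α ; fzero (fsuc fzero) → first α β
       ; (fsuc fzero) fzero → second δ γ ; (fsuc fzero) (fsuc fzero) → first γ δ })
    where
    swap : Mat 2 2 ℕ
    swap = arrow 0 (λ _ → 1) (λ _ → 1) (λ _ → 0)
    first′ : ∀ a b → a ≡ a * 1 + (b * 0 + 0)
    first′ = solve-∀
    second′ : ∀ a b → a ≡ b * 0 + (a * 1 + 0)
    second′ = solve-∀
    first : ∀ a b → a ≋ a * 1 + (b * 0 + 0)
    first a b = ≋-reflexive (first′ a b)
    second : ∀ a b → a ≋ b * 0 + (a * 1 + 0)
    second a b = ≋-reflexive (second′ a b)

  ≅-null : ∀ {A B : Mat 1 1 ℕ} → A fzero fzero ≋ 0 → B fzero fzero ≋ 0 → A ≅ B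
  ≅-null {A} {B} A≈0 B≈0 = ≅-associates A B 0 0
    (≋-trans A≈0 (≋-reflexive (sym (*-zeroʳ (B fzero fzero)))))
    (≋-trans B≈0 (≋-reflexive (sym (*-zeroʳ (A fzero fzero)))))

-- p-adic integers and units modulo p²

module PAdic (p : ℕ) (pp : Prime p) where

  instance
    p-nonZero : NonZero p
    p-nonZero = prime⇒nonZero pp

    p²-nonZero : NonZero (p ^ 2)
    p²-nonZero = m^n≢0 p 2

  module P = Congruence p
  open Congruence (p ^ 2)
  open Arrowhead (p ^ 2)

  p²≡p*p : p ^ 2 ≡ p * p
  p²≡p*p = cong (p *_) (*-identityʳ p)

  partialSum : (ℕ → ℕ) → ℕ → ℕ
  partialSum digit zero    = 0
  partialSum digit (suc k) = partialSum digit k + digit k * p ^ k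

  partialSum< : ∀ digit → (∀ k → digit k < p) → ∀ k → partialSum digit k < p ^ k
  partialSum< digit digit<p zero    = s≤s z≤n
  partialSum< digit digit<p (suc k) = begin-strict
    partialSum digit k + digit k * p ^ k <⟨ +-monoˡ-< (digit k * p ^ k) (partialSum< digit digit<p k) ⟩
    suc (digit k) * p ^ k                ≤⟨ *-monoˡ-≤ (p ^ k) (digit<p k) ⟩
    p * p ^ k                            ∎
    where open ≤-Reasoning

  fromDigits : (digit : ℕ → ℕ) → (∀ k → digit k < p) → ℤₚ p
  fromDigits digit digit<p = record
    { seq = partialSum digit ; seq-lt = partialSum< digit digit<p ; seq-coh = λ k → digit k , refl }

  -- only the two lowest base-p digits of c matter: they determine its reduction mod p²
  lowDigit : ℕ → ℕ → ℕ
  lowDigit c zero          = c % p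
  lowDigit c (suc zero)    = (c / p) % p
  lowDigit c (suc (suc _)) = 0

  lowDigit<p : ∀ c k → lowDigit c k < p
  lowDigit<p c zero          = m%n<n c p
  lowDigit<p c (suc zero)    = m%n<n (c / p) p
  lowDigit<p c (suc (suc k)) = >-nonZero⁻¹ p

  embed : ℕ → ℤₚ p
  embed c = fromDigits (lowDigit c) (lowDigit<p c)

  red2-embed : ∀ c → red 2 (embed c) ≋ c
  red2-embed c = (c / p) / p , 0 , (begin
    0 + c % p * 1 + (c / p) % p * (p * 1) + (c / p) / p * (p * (p * 1))
      ≡⟨ digits (c % p) ((c / p) % p) ((c / p) / p) p ⟩
    c % p + ((c / p) % p + (c / p) / p * p) * p
      ≡⟨ cong (λ z → c % p + z * p) (sym (m≡m%n+[m/n]*n (c / p) p)) ⟩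
    c % p + (c / p) * p ≡⟨ sym (m≡m%n+[m/n]*n c p) ⟩
    c                   ≡⟨ sym (+-identityʳ c) ⟩
    c + 0 * p ^ 2       ∎)
    where
    open ≡-Reasoning
    digits : ∀ a b c p → 0 + a * 1 + b * (p * 1) + c * (p * (p * 1)) ≡ a + (b + c * p) * p
    digits = solve-∀

  mod-p²⇒mod-p : ∀ {x y} → x ≋ y → x P.≋ y
  mod-p²⇒mod-p {x} {y} (a , b , e) = a * p , b * p , (begin
    x + a * p * p   ≡⟨ cong (x +_) (trans (*-assoc a p p) (cong (a *_) (sym p²≡p*p))) ⟩
    x + a * p ^ 2   ≡⟨ e ⟩
    y + b * p ^ 2   ≡⟨ cong (y +_) (trans (cong (b *_) p²≡p*p) (sym (*-assoc b p p))) ⟩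
    y + b * p * p   ∎)
    where open ≡-Reasoning

  red2≋red1 : (x : ℤₚ p) → red 2 x P.≋ red 1 x
  red2≋red1 x with seq-coh x 1
  ... | a , e = 0 , a , trans (+-identityʳ _) (trans e (cong (λ z → seq x 1 + a * z) (*-identityʳ p)))

  red1<p : (x : ℤₚ p) → red 1 x < p
  red1<p x = subst (red 1 x <_) (*-identityʳ p) (seq-lt x 1)

  coprime-p : ∀ {u} → ¬ p ∣ u → Coprime p u
  coprime-p {u} p∤u {i} (i∣p , i∣u) with prime⇒irreducible pp i∣p
  ... | inj₁ i≡1 = i≡1
  ... | inj₂ i≡p = contradiction (subst (_∣ u) i≡p i∣u) p∤u

  coprime-p² : ∀ {u} → ¬ p ∣ u → Coprime (p ^ 2) u
  coprime-p² {u} p∤u {i} (i∣p² , i∣u) = coprime-p p∤u (i∣p , i∣u)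
    where
    i∣p : i ∣ p
    i∣p = coprime-divisor (λ (g∣i , g∣p) → coprime-p p∤u (g∣p , ∣-trans g∣i i∣u))
                          (subst (i ∣_) p²≡p*p i∣p²)

  invertible : ∀ {u} → ¬ p ∣ u → Σ ℕ λ w → u * w ≋ 1
  invertible {u} p∤u with coprime-Bézout (Coprimality.sym (coprime-p² p∤u))
  ... | Bézout.+- x y eq = x , 0 , y , trans (+-identityʳ _) (trans (*-comm u x) (sym eq))
  ... | Bézout.-+ x y eq = q-1 * x , ≋-sym (begin
    1             ≈⟨ +≋0⇒≋q-1* (≋-trans (≋-reflexive eq) (multiple≋0 y)) ⟩
    q-1 * (x * u) ≡⟨ rearrange q-1 x u ⟩
    u * (q-1 * x) ∎)
    where
    open ≋-Reasoning
    rearrange : ∀ r x u → r * (x * u) ≡ u * (r * x)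
    rearrange = solve-∀

  reduced-≋⇒≡ : ∀ {x y} → x < p → y < p → x P.≋ y → x ≡ y
  reduced-≋⇒≡ {x} {y} x<p y<p (a , b , e) = begin
    x                 ≡⟨ sym (m<n⇒m%n≡m x<p) ⟩
    x % p             ≡⟨ sym ([m+kn]%n≡m%n x a p) ⟩
    (x + a * p) % p   ≡⟨ cong (_% p) e ⟩
    (y + b * p) % p   ≡⟨ [m+kn]%n≡m%n y b p ⟩
    y % p             ≡⟨ m<n⇒m%n≡m y<p ⟩
    y                 ∎
    where open ≡-Reasoning

  distinct⇒invertible : ∀ (s t : ℤₚ p) {u} → ¬ red 1 s ≡ red 1 t →
    u P.≋ red 2 s + q-1 * red 2 t → Σ ℕ λ w → u * w ≋ 1
  distinct⇒invertible s t {u} s≢t u≈s-t =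
    invertible λ p∣u → s≢t (reduced-≋⇒≡ (red1<p s) (red1<p t) (s≈t p∣u))
    where
    s≈t : p ∣ u → red 1 s P.≋ red 1 t
    s≈t (divides k u≡kp) = begin
      red 1 s                            ≈⟨ P.≋-sym (red2≋red1 s) ⟩
      red 2 s                            ≡⟨ sym (+-identityʳ _) ⟩
      red 2 s + 0                        ≈⟨ P.+-cong P.≋-refl (mod-p²⇒mod-p (≋-sym (q-1-inverse (red 2 t)))) ⟩
      red 2 s + (red 2 t + q-1 * red 2 t) ≡⟨ +-right-comm′ (red 2 s) (red 2 t) (q-1 * red 2 t) ⟩
      red 2 s + q-1 * red 2 t + red 2 t  ≈⟨ P.+-cong (P.≋-sym u≈s-t) P.≋-refl ⟩
      u + red 2 t                        ≈⟨ P.+-cong (0 , k , trans (+-identityʳ u) u≡kp) P.≋-refl ⟩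
      0 + red 2 t                        ≈⟨ red2≋red1 t ⟩
      red 1 t                            ∎
      where
      open P.≋-Reasoning
      +-right-comm′ : ∀ a b c → a + (b + c) ≡ a + c + b
      +-right-comm′ = solve-∀

  quadratic : ∀ {n} → (A₀ A₁ A₂ : Mat n n ℕ) → FirstIntegral p n
  quadratic A₀ A₁ A₂ = record { deg = 1 ; coef = λ k i j → embed (coefficient k i j) }
    where
    coefficient : Fin 3 → Mat _ _ ℕ
    coefficient fzero        = A₀
    coefficient (fsuc fzero) = A₁
    coefficient (fsuc (fsuc _)) = A₂

  evalMod2-quadratic : ∀ {n} (A₀ A₁ A₂ : Mat n n ℕ) t →
    evalMod2 (quadratic A₀ A₁ A₂) t ≋ₘ λ i j → A₀ i j + red 2 t * A₁ i j + p * (red 2 t * red 2 t) * A₂ i j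
  evalMod2-quadratic A₀ A₁ A₂ t i j = begin
    1 * 1 * red 2 (embed (A₀ i j)) + (1 * (x * 1) * red 2 (embed (A₁ i j))
      + (p * 1 * (x * (x * 1)) * red 2 (embed (A₂ i j)) + 0))
      ≈⟨ +-cong (*-congˡ (1 * 1) (red2-embed _)) (+-cong (*-congˡ (1 * (x * 1)) (red2-embed _))
                                                        (+-cong (*-congˡ (p * 1 * (x * (x * 1))) (red2-embed _)) ≋-refl)) ⟩
    1 * 1 * A₀ i j + (1 * (x * 1) * A₁ i j + (p * 1 * (x * (x * 1)) * A₂ i j + 0))
      ≡⟨ normalise p x (A₀ i j) (A₁ i j) (A₂ i j) ⟩
    A₀ i j + x * A₁ i j + p * (x * x) * A₂ i j ∎
    where
    open ≋-Reasoning
    x = red 2 t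
    normalise : ∀ p x a b c → 1 * 1 * a + (1 * (x * 1) * b + (p * 1 * (x * (x * 1)) * c + 0)) ≡ a + x * b + p * (x * x) * c
    normalise = solve-∀

  pow∞≋0 : ∀ e → Ge2 e → pow∞ p e ≋ 0
  pow∞≋0 ∞       _   = ≋-refl
  pow∞≋0 (fin k) 2≤k = ≋-trans (≋-reflexive (begin
    p ^ k             ≡⟨ cong (p ^_) (sym (m+[n∸m]≡n 2≤k)) ⟩
    p ^ (2 + (k ∸ 2)) ≡⟨ ^-distribˡ-+-* p 2 (k ∸ 2) ⟩
    p ^ 2 * p ^ (k ∸ 2) ≡⟨ *-comm (p ^ 2) _ ⟩
    p ^ (k ∸ 2) * p ^ 2 ∎)) (multiple≋0 (p ^ (k ∸ 2)))
    where open ≡-Reasoning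

  ≅-Fp² : ∀ {s c} → s ≋ 0 → c ≋ p → arrow s (λ _ → p) (λ _ → q-1 * p) (λ _ → c) ≅ presH p Fp2
  ≅-Fp² {s} {c} s≈0 c≈p = ≅-sameImage A (presH p Fp2) K₁ K₂
    (λ { fzero fzero               → ≋-trans s≈0 (≋-reflexive (sym (e₀₀ p q-1)))
       ; fzero (fsuc fzero)        → ≋-reflexive (sym (e₀₁ p))
       ; (fsuc fzero) fzero        → ≋-reflexive (sym (e₁₀ p q-1))
       ; (fsuc fzero) (fsuc fzero) → ≋-trans c≈p (≋-reflexive (sym (e₁₁ p))) })
    (λ { fzero fzero               → ≋-sym (begin
           s * 1 + (p * 1 + 0) ≈⟨ +-cong (*-congʳ 1 s≈0) (≋-refl {p * 1 + 0}) ⟩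
           0 * 1 + (p * 1 + 0) ≡⟨ +-identityʳ (p * 1) ⟩
           p * 1               ∎)
       ; fzero (fsuc fzero)        → ≋-sym (begin
           s * q-1 + (p * 0 + 0) ≈⟨ +-cong (*-congʳ q-1 s≈0) (≋-refl {p * 0 + 0}) ⟩
           0 * q-1 + (p * 0 + 0) ≡⟨ trans (+-identityʳ (p * 0)) (*-zeroʳ p) ⟩
           0                     ∎)
       ; (fsuc fzero) fzero        → ≋-sym (begin
           q-1 * p * 1 + (c * 1 + 0) ≈⟨ +-cong (≋-refl {q-1 * p * 1}) (+-cong (*-congʳ 1 c≈p) (≋-refl {0})) ⟩
           q-1 * p * 1 + (p * 1 + 0) ≡⟨ e₁₀′ p q-1 ⟩
           p + q-1 * p               ≈⟨ q-1-inverse p ⟩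
           0                         ∎)
       ; (fsuc fzero) (fsuc fzero) → ≋-sym (begin
           q-1 * p * q-1 + (c * 0 + 0) ≡⟨ e₁₁′ p q-1 c ⟩
           q-1 * q-1 * p               ≈⟨ *-congʳ p q-1²≋1 ⟩
           1 * p                       ≡⟨ *-comm 1 p ⟩
           p * 1                       ∎) })
    where
    open ≋-Reasoning
    A : Mat 2 2 ℕ
    A = arrow s (λ _ → p) (λ _ → q-1 * p) (λ _ → c)
    K₁ K₂ : Mat 2 2 ℕ
    K₁ = arrow 0 (λ _ → 1) (λ _ → q-1) (λ _ → 1)
    K₂ = arrow 1 (λ _ → q-1) (λ _ → 1) (λ _ → 0)
    e₀₀ : ∀ p r → p * 1 * 0 + (0 * r + 0) ≡ 0
    e₀₀ = solve-∀
    e₀₁ : ∀ p → p * 1 * 1 + (0 * 1 + 0) ≡ p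
    e₀₁ = solve-∀
    e₁₀ : ∀ p r → 0 * 0 + (p * 1 * r + 0) ≡ r * p
    e₁₀ = solve-∀
    e₁₁ : ∀ p → 0 * 1 + (p * 1 * 1 + 0) ≡ p
    e₁₁ = solve-∀
    e₁₀′ : ∀ p r → r * p * 1 + (p * 1 + 0) ≡ p + r * p
    e₁₀′ = solve-∀
    e₁₁′ : ∀ p r c → r * p * r + (c * 0 + 0) ≡ r * r * p
    e₁₁′ = solve-∀

  arrowIntegral : ∀ {d} (α₀ α₁ α₂ : ℕ) (β γ D₀ : Fin d → ℕ) → FirstIntegral p (suc d)
  arrowIntegral α₀ α₁ α₂ β γ D₀ =
    quadratic (arrow α₀ β γ D₀) (arrow α₁ (λ _ → 0) (λ _ → 0) (λ _ → 1))
              (arrow α₂ (λ _ → 0) (λ _ → 0) (λ _ → 0))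

  evalMod2-arrowIntegral : ∀ {d} α₀ α₁ α₂ (β γ D₀ : Fin d → ℕ) t → let x = red 2 t in
    evalMod2 (arrowIntegral α₀ α₁ α₂ β γ D₀) t ≋ₘ
    arrow (α₀ + x * α₁ + p * (x * x) * α₂) β γ (λ k → x + D₀ k)
  evalMod2-arrowIntegral α₀ α₁ α₂ β γ D₀ t i j = ≋-trans
    (evalMod2-quadratic (arrow α₀ β γ D₀) (arrow α₁ (λ _ → 0) (λ _ → 0) (λ _ → 1))
                        (arrow α₂ (λ _ → 0) (λ _ → 0) (λ _ → 0)) t i j)
    (≋-reflexive (combine i j))
    where
    x = red 2 t
    y = p * (x * x)
    drop : ∀ b x y → b + x * 0 + y * 0 ≡ b
    drop = solve-∀
    shift : ∀ D x y → D + x * 1 + y * 0 ≡ x + D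
    shift = solve-∀
    diagonal-shift : ∀ {n} (D : Fin n → ℕ) k l →
      diagonal D k l + x * identity k l + y * diagonal (λ _ → 0) k l ≡ diagonal (λ i → x + D i) k l
    diagonal-shift D fzero    fzero    = shift (D fzero) x y
    diagonal-shift D fzero    (fsuc l) = drop 0 x y
    diagonal-shift D (fsuc k) fzero    = drop 0 x y
    diagonal-shift D (fsuc k) (fsuc l) = diagonal-shift (λ i → D (fsuc i)) k l
    combine : ∀ i j → arrow α₀ β γ D₀ i j + x * arrow α₁ (λ _ → 0) (λ _ → 0) (λ _ → 1) i j
                      + y * arrow α₂ (λ _ → 0) (λ _ → 0) (λ _ → 0) i j
                      ≡ arrow (α₀ + x * α₁ + y * α₂) β γ (λ k → x + D₀ k) i j
    combine fzero    fzero    = refl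
    combine fzero    (fsuc l) = drop (β l) x y
    combine (fsuc k) fzero    = drop (γ k) x y
    combine (fsuc k) (fsuc l) = diagonal-shift D₀ k l

-- The first integrals realising the two families

module Configuration (p : ℕ) (pp : Prime p) {m : ℕ} (X : Fin m → ℤₚ p) (X-distinct : DistinctModP X)
                     (σ : Permutation′ m) where
  open PAdic p pp
  open Congruence (p ^ 2)
  open Arrowhead (p ^ 2)
  open SmallCokernels (p ^ 2)

  position : Fin m → ℕ
  position i = toℕ (σ ⟨$⟩ʳ i)

  -- the point at position n of σ · X, junk 0 past m
  point : ℕ → ℕ
  point n with n <? m
  ... | yes n<m = red 2 (X (σ ⟨$⟩ˡ fromℕ< n<m))
  ... | no  _   = 0

  point-position : ∀ i → point (position i) ≡ red 2 (X i)
  point-position i with position i <? m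
  ... | yes lt = cong (λ ι → red 2 (X ι)) (trans (cong (σ ⟨$⟩ˡ_) (fromℕ<-toℕ (σ ⟨$⟩ʳ i) lt)) (inverseˡ σ))
  ... | no ¬lt = contradiction (toℕ<n (σ ⟨$⟩ʳ i)) ¬lt

  invertible-at : ∀ i {n u} → n < m → ¬ n ≡ position i →
    u P.≋ red 2 (X i) + q-1 * point n → Σ ℕ λ w → u * w ≋ 1
  invertible-at i {n} n<m n≢i u≈ with n <? m
  ... | yes lt = distinct⇒invertible (X i) (X (σ ⟨$⟩ˡ fromℕ< lt)) (λ e → n≢i (same-position e)) u≈
    where
    same-position : red 1 (X i) ≡ red 1 (X (σ ⟨$⟩ˡ fromℕ< lt)) → n ≡ position i
    same-position e = trans (sym (toℕ-fromℕ< lt))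
      (cong toℕ (trans (sym (inverseʳ σ)) (cong (σ ⟨$⟩ʳ_) (sym (X-distinct e)))))
  ... | no ¬lt = contradiction n<m ¬lt

  inverseOrZero : ∀ i {n u} → n < m → u P.≋ red 2 (X i) + q-1 * point n →
    Σ ℕ λ w → (n ≡ position i → w ≡ 0) × (¬ n ≡ position i → u * w ≋ 1)
  inverseOrZero i {n} n<m u≈ with n ℕ.≟ position i
  ... | yes n≡i = 0 , (λ _ → refl) , (λ n≢i → contradiction n≡i n≢i)
  ... | no n≢i  = proj₁ (invertible-at i n<m n≢i u≈) , (λ n≡i → contradiction n≡i n≢i) ,
                  (λ _ → proj₂ (invertible-at i n<m n≢i u≈))

  own-factor≋0 : ∀ i {n} → n ≡ position i → red 2 (X i) + q-1 * point n ≋ 0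
  own-factor≋0 i refl = ≋-trans (≋-reflexive (cong (λ z → red 2 (X i) + q-1 * z) (point-position i)))
                                (q-1-inverse (red 2 (X i)))

  module TailInverse (i : Fin m) {d} (d≤m : d ≤ m) (D : Fin d → ℕ)
                     (D≈ : ∀ l → D l P.≋ red 2 (X i) + q-1 * point (toℕ l)) where

    private
      choice : ∀ l → Σ ℕ λ w → (toℕ l ≡ position i → w ≡ 0) × (¬ toℕ l ≡ position i → D l * w ≋ 1)
      choice l = inverseOrZero i (<-≤-trans (toℕ<n l) d≤m) (D≈ l)

    w : Fin d → ℕ
    w l = proj₁ (choice l)

    w-inverse : ∀ l → ¬ toℕ l ≡ position i → D l * w l ≋ 1
    w-inverse l = proj₂ (proj₂ (choice l))

    inverse-beyond : d ≤ position i → ∀ l → D l * w l ≋ 1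
    inverse-beyond d≤i l = w-inverse l (λ l≡i → <⇒≢ (<-≤-trans (toℕ<n l) d≤i) l≡i)

    w-atPosition : (i<d : position i < d) → w (fromℕ< i<d) ≋ 0
    w-atPosition i<d = ≋-reflexive (proj₁ (proj₂ (choice (fromℕ< i<d))) (toℕ-fromℕ< i<d))

    inverse-offPosition : (i<d : position i < d) → ∀ l → ¬ l ≡ fromℕ< i<d → D l * w l ≋ 1
    inverse-offPosition i<d l l≢k = w-inverse l (λ l≡i → l≢k (toℕ-injective (trans l≡i (sym (toℕ-fromℕ< i<d)))))

  module FirstFamily (d : ℕ) (d+2≤m : d + 2 ≤ m) (rs : ℕ → ℕ∞) (rs≥2 : ∀ j → j < d + 2 → Ge2 (rs j)) where

    d+2≤m′ : suc (suc d) ≤ m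
    d+2≤m′ = subst (_≤ m) (+-comm d 2) d+2≤m

    d+1≤m : suc d ≤ m
    d+1≤m = ≤-trans (n≤1+n (suc d)) d+2≤m′

    d≤m : d ≤ m
    d≤m = ≤-trans (n≤1+n d) d+1≤m

    a b : ℕ
    a = point d
    b = point (suc d)

    c : Fin d → ℕ
    c k = point (toℕ k)

    T : ℕ → ℕ
    T x = p * ((x + q-1 * a) * (x + q-1 * b))

    E₁ : ℕ → Mat (suc d) (suc d) ℕ
    E₁ x = arrow (T x) (λ _ → 0) (λ _ → 1) (λ k → x + q-1 * c k)

    P₁ : FirstIntegral p (suc d)
    P₁ = arrowIntegral (p * (q-1 * a) * (q-1 * b)) (p * (q-1 * a + q-1 * b)) 1 (λ _ → 0) (λ _ → 1) (λ k → q-1 * c k)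

    evalMod2-P₁ : ∀ t → evalMod2 P₁ t ≋ₘ E₁ (red 2 t)
    evalMod2-P₁ t i j = ≋-trans (evalMod2-arrowIntegral _ _ 1 (λ _ → 0) (λ _ → 1) (λ k → q-1 * c k) t i j)
      (arrow-cong (≋-reflexive (factor p (red 2 t) q-1 a b)) (λ _ → ≋-refl) (λ _ → ≋-refl) (λ _ → ≋-refl) i j)
      where
      factor : ∀ p x r a b → p * (r * a) * (r * b) + x * (p * (r * a + r * b)) + p * (x * x) * 1 ≡
                             p * ((x + r * a) * (x + r * b))
      factor = solve-∀

    module At (i : Fin m) where

      x : ℕ
      x = red 2 (X i)

      D : Fin d → ℕ
      D k = x + q-1 * c k

      open TailInverse i d≤m D (λ _ → P.≋-refl)

      cokernel-tail : (i<d : position i < d) → ∀ {B : Mat 1 1 ℕ} → B fzero fzero ≋ 0 → E₁ x ≅ B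
      cokernel-tail i<d B≈0 =
        ≅-trans (arrow-eliminateTailExcept (T x) (λ _ → 0) (λ _ → 1) D w k₀
                                           (w-atPosition i<d) (inverse-offPosition i<d))
        (≅-trans (arrow-swapColumns S 0 1 (D k₀))
        (≅-trans (arrow-eliminateTail 0 (λ _ → S) (λ _ → D k₀) (λ _ → 1) (λ _ → 1) (λ _ → ≋-refl))
                 (≅-null (≋-trans (≋-reflexive (+-identityʳ _)) (*-≋0ʳ S (*-≋0ʳ q-1 (*-≋0ʳ 1 Dk₀≈0))))
                         B≈0)))
        where
        k₀ = fromℕ< i<d
        S = schur (T x) (λ _ → 0) (λ _ → 1) w
        Dk₀≈0 : D k₀ ≋ 0
        Dk₀≈0 = own-factor≋0 i (toℕ-fromℕ< i<d)

      cokernel-extraRoot : ¬ position i < d → position i < suc (suc d) →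
        ∀ {B : Mat 1 1 ℕ} → B fzero fzero ≋ 0 → E₁ x ≅ B
      cokernel-extraRoot ¬i<d i<d+2 B≈0 =
        ≅-trans (arrow-eliminateTail (T x) (λ _ → 0) (λ _ → 1) D w (inverse-beyond d≤i))
                (≅-null (≋-trans (≋-reflexive (schur-zeroRow (T x) (λ _ → 1) w)) (*-≋0ʳ p Tx≈0)) B≈0)
        where
        d≤i : d ≤ position i
        d≤i = ≮⇒≥ ¬i<d
        Tx≈0 : (x + q-1 * a) * (x + q-1 * b) ≋ 0
        Tx≈0 with m≤n⇒m<n∨m≡n d≤i
        ... | inj₂ d≡i = *-congʳ (x + q-1 * b) (own-factor≋0 i d≡i)
        ... | inj₁ d<i = *-≋0ʳ (x + q-1 * a) (own-factor≋0 i (≤-antisym d<i (≤-pred i<d+2)))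

      cokernel-generic : ¬ position i < suc (suc d) → E₁ x ≅ presH p (cyc (fin 1))
      cokernel-generic ¬i<d+2 =
        ≅-trans (arrow-eliminateTail (T x) (λ _ → 0) (λ _ → 1) D w (inverse-beyond (<⇒≤ d<i)))
                (≅-associates _ _ ((x + q-1 * a) * (x + q-1 * b)) (wa * wb)
                  (≋-reflexive (trans (schur-zeroRow (T x) (λ _ → 1) w)
                                      (cong (_* ((x + q-1 * a) * (x + q-1 * b))) (sym (*-identityʳ p)))))
                  (≋-sym (begin
                    schur (T x) (λ _ → 0) (λ _ → 1) w * (wa * wb)
                      ≡⟨ cong (_* (wa * wb)) (schur-zeroRow (T x) (λ _ → 1) w) ⟩
                    p * ((x + q-1 * a) * (x + q-1 * b)) * (wa * wb)      ≡⟨ regroup p (x + q-1 * a) (x + q-1 * b) wa wb ⟩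
                    p * (((x + q-1 * a) * wa) * ((x + q-1 * b) * wb))
                      ≈⟨ *-congˡ p (*-cong (proj₂ a-unit) (proj₂ b-unit)) ⟩
                    p * 1                                                ∎)))
        where
        open ≋-Reasoning
        d+2≤i : suc (suc d) ≤ position i
        d+2≤i = ≮⇒≥ ¬i<d+2
        d<i : d < position i
        d<i = <-trans (n<1+n d) d+2≤i
        a-unit : Σ ℕ λ w → (x + q-1 * a) * w ≋ 1
        a-unit = invertible-at i (<-≤-trans (n<1+n d) d+1≤m) (<⇒≢ d<i) P.≋-refl
        b-unit : Σ ℕ λ w → (x + q-1 * b) * w ≋ 1
        b-unit = invertible-at i d+2≤m′ (<⇒≢ d+2≤i) P.≋-refl
        wa wb : ℕ
        wa = proj₁ a-unit
        wb = proj₁ b-unit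
        regroup : ∀ p u v w z → p * (u * v) * (w * z) ≡ p * ((u * w) * (v * z))
        regroup = solve-∀

      target≈0 : position i < suc (suc d) → pow∞ p (rs (position i)) ≋ 0
      target≈0 i<d+2 = pow∞≋0 (rs (position i)) (rs≥2 (position i) (subst (position i <_) (+-comm 2 d) i<d+2))

      cokernel : E₁ x ≅ presH p (base1 d rs (σ ⟨$⟩ʳ i))
      cokernel with toℕ (σ ⟨$⟩ʳ i) <? suc (suc d)
      ... | no ¬i<d+2 = cokernel-generic ¬i<d+2
      ... | yes i<d+2 with toℕ (σ ⟨$⟩ʳ i) <? d
      ...   | yes i<d = cokernel-tail i<d (target≈0 i<d+2)
      ...   | no ¬i<d = cokernel-extraRoot ¬i<d i<d+2 (target≈0 i<d+2)

    P₁-cokernel : ∀ i → evalMod2 P₁ (X i) ≅ presH p (base1 d rs (σ ⟨$⟩ʳ i))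
    P₁-cokernel i = ≅-trans (≋ₘ⇒≅ (evalMod2-P₁ (X i))) (At.cokernel i)

  module SecondFamily (d : ℕ) (d≤m : d ≤ m) (rs : ℕ → ℕ∞) (rs≥2 : ∀ j → j < m ∸ d → Ge2 (rs j)) where

    c : Fin d → ℕ
    c k = point (toℕ k)

    E₂ : ℕ → Mat (suc d) (suc d) ℕ
    E₂ x = arrow 0 (λ _ → p) (λ _ → q-1 * p) (λ k → x + (q-1 * c k + p))

    P₂ : FirstIntegral p (suc d)
    P₂ = arrowIntegral 0 0 0 (λ _ → p) (λ _ → q-1 * p) (λ k → q-1 * c k + p)

    evalMod2-P₂ : ∀ t → evalMod2 P₂ t ≋ₘ E₂ (red 2 t)
    evalMod2-P₂ t i j = ≋-trans (evalMod2-arrowIntegral 0 0 0 (λ _ → p) (λ _ → q-1 * p) (λ k → q-1 * c k + p) t i j)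
      (arrow-cong (≋-reflexive (vanish (red 2 t) (p * (red 2 t * red 2 t))))
                  (λ _ → ≋-refl) (λ _ → ≋-refl) (λ _ → ≋-refl) i j)
      where
      vanish : ∀ x y → 0 + x * 0 + y * 0 ≡ 0
      vanish = solve-∀

    module At (i : Fin m) where

      x : ℕ
      x = red 2 (X i)

      D : Fin d → ℕ
      D k = x + (q-1 * c k + p)

      D≈ : ∀ k → D k P.≋ x + q-1 * c k
      D≈ k = P.≋-trans (P.≋-reflexive (sym (+-assoc x (q-1 * c k) p)))
                       (P.≋-trans (P.+-cong P.≋-refl p≈0) (P.≋-reflexive (+-identityʳ _)))
        where
        p≈0 : p P.≋ 0
        p≈0 = P.≋-trans (P.≋-reflexive (sym (*-identityˡ p))) (P.multiple≋0 1)

      open TailInverse i d≤m D D≈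

      schur≋0 : schur 0 (λ _ → p) (λ _ → q-1 * p) w ≋ 0
      schur≋0 = ≋-trans (sumF-cong≋ d λ l → ≋-trans (≋-reflexive (regroup p q-1 (w l)))
                                                     (multiple≋0 (q-1 * (w l * q-1))))
                        (≋-reflexive (sumF-zero d))
        where
        regroup : ∀ p r v → p * (r * (v * (r * p))) ≡ r * (v * r) * (p * (p * 1))
        regroup = solve-∀

      cokernel : E₂ x ≅ presH p (base2 d rs (σ ⟨$⟩ʳ i))
      cokernel with toℕ (σ ⟨$⟩ʳ i) <? d
      ... | yes i<d = ≅-trans (arrow-eliminateTailExcept 0 (λ _ → p) (λ _ → q-1 * p) D w (fromℕ< i<d)
                                                    (w-atPosition i<d) (inverse-offPosition i<d))
                              (≅-Fp² schur≋0 Dk₀≈p)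
        where
        Dk₀≈p : D (fromℕ< i<d) ≋ p
        Dk₀≈p = ≋-trans (≋-reflexive (sym (+-assoc x _ p))) (+-cong (own-factor≋0 i (toℕ-fromℕ< i<d)) ≋-refl)
      ... | no ¬i<d = ≅-trans (arrow-eliminateTail 0 (λ _ → p) (λ _ → q-1 * p) D w (inverse-beyond (≮⇒≥ ¬i<d)))
                              (≅-null schur≋0 (pow∞≋0 _ (rs≥2 _ (∸-monoˡ-< (toℕ<n (σ ⟨$⟩ʳ i))
                                                                            (≮⇒≥ ¬i<d)))))

    P₂-cokernel : ∀ i → evalMod2 P₂ (X i) ≅ presH p (base2 d rs (σ ⟨$⟩ʳ i))
    P₂-cokernel i = ≅-trans (≋ₘ⇒≅ (evalMod2-P₂ (X i))) (At.cokernel i)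

lemma3p13 : (p : ℕ) → Prime p → (m : ℕ) → (X : Fin m → ℤₚ p) → DistinctModP X →
    (n : ℕ) → (H : Fin m → Mod) → InD m n H → InC p m X n H
lemma3p13 p pp m X X-distinct .(suc d) H (inj₁ (d , d+2≤m , rs , rs≥2 , σ , refl , H≡ , inB)) =
  inB , P₁ , λ i → subst (λ Hᵢ → CokIso (p ^ 2) (evalMod2 P₁ (X i)) (presH p Hᵢ)) (sym (H≡ i))
                         (_≅_.cokIso (P₁-cokernel i))
  where
  open Congruence (p ^ 2) using (_≅_)
  open Configuration p pp X X-distinct σ
  open FirstFamily d d+2≤m rs rs≥2
lemma3p13 p pp m X X-distinct .(suc d) H (inj₂ (d , d≤m , rs , rs≥2 , σ , refl , H≡ , inB)) =
  inB , P₂ , λ i → subst (λ Hᵢ → CokIso (p ^ 2) (evalMod2 P₂ (X i)) (presH p Hᵢ)) (sym (H≡ i))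
                         (_≅_.cokIso (P₂-cokernel i))
  where
  open Congruence (p ^ 2) using (_≅_)
  open Configuration p pp X X-distinct σ
  open SecondFamily d d≤m rs rs≥2
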